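{- The algebraic equation $t(1+tx)-tW+2tx^2W^2+x^3W^4=0$ has a unique solution $W\in\mathbf{R}$. This solution satisfies $W\equiv 1+tx\pmod{x^2}$ and is a common solution of the partial differential equations $D_LW=D_RW$ and $\tilde D_LW=\tilde D_RW$.
   Context: $\mathbf{R}=\left(\mathbb{Q}[t,t^{ -1}]\right)[[x]]$. Let $\theta_t=t\frac{\partial}{\partial t}$, $\theta_x=x\frac{\partial}{\partial x}$ act on $\mathbf{R}$. Define (products are compositions; prefactors act by multiplication after the differential parts): $D_L=4tx\,(1+\theta_t+\theta_x)(2-3\theta_t+\theta_x)$, $D_R=(3\theta_t+\theta_x)(-2+3\theta_t+\theta_x)$, $\tilde D_L=4x\,(1-\theta_t+\theta_x)(3\theta_t+\theta_x)$, $\tilde D_R=t\,(2-3\theta_t+\theta_x)(-3\theta_t+\theta_x)$. -}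

module Defs where

open import Data.Nat as ℕ using (ℕ; zero; suc; _∸_)
open import Data.Integer as ℤ using (ℤ; +_; -[1+_])
open import Data.Rational as ℚ using (ℚ; 0ℚ; 1ℚ)
open import Data.List using (List; []; _∷_; map; replicate; _++_)
open import Relation.Binary.PropositionalEquality using (_≡_)

ℤtoℚ : ℤ → ℚ
ℤtoℚ i = i ℚ./ 1

ℕtoℚ : ℕ → ℚ
ℕtoℚ n = ℤtoℚ (+ n)

-- Polynomials in t over ℚ as coefficient lists (index i = coefficient of t^i)

addP : List ℚ → List ℚ → List ℚ
addP []       q        = q
addP (a ∷ p)  []       = a ∷ p
addP (a ∷ p)  (b ∷ q)  = (a ℚ.+ b) ∷ addP p q

scaleP : ℚ → List ℚ → List ℚ
scaleP c = map (c ℚ.*_)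

mulP : List ℚ → List ℚ → List ℚ
mulP []      q = []
mulP (a ∷ p) q = addP (scaleP a q) (0ℚ ∷ mulP p q)

nth : ℕ → List ℚ → ℚ
nth _       []      = 0ℚ
nth zero    (a ∷ p) = a
nth (suc n) (a ∷ p) = nth n p

weightP : ℤ → List ℚ → List ℚ
weightP e []      = []
weightP e (a ∷ p) = (ℤtoℚ e ℚ.* a) ∷ weightP (e ℤ.+ + 1) p

-- Laurent polynomials ℚ[t,t⁻¹]:  mkL k p  represents  t^(-k) · Σ_i p_i t^i

record Laurent : Set where
  constructor mkL
  field
    shift : ℕ
    poly  : List ℚ
open Laurent public

coeffL : Laurent → ℤ → ℚ
coeffL (mkL k p) m with m ℤ.+ + k
... | + j     = nth j p
... | -[1+ _ ] = 0ℚ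

_≈L_ : Laurent → Laurent → Set
a ≈L b = ∀ (m : ℤ) → coeffL a m ≡ coeffL b m

0L : Laurent
0L = mkL 0 []

constL : ℚ → Laurent
constL c = mkL 0 (c ∷ [])

_+L_ : Laurent → Laurent → Laurent
mkL k p +L mkL l q = mkL (k ℕ.+ l) (addP (replicate l 0ℚ ++ p) (replicate k 0ℚ ++ q))

_*L_ : Laurent → Laurent → Laurent
mkL k p *L mkL l q = mkL (k ℕ.+ l) (mulP p q)

scaleL : ℚ → Laurent → Laurent
scaleL c (mkL k p) = mkL k (scaleP c p)

tL : Laurent → Laurent
tL (mkL k p) = mkL k (0ℚ ∷ p)

-- θ_t = t ∂/∂t : coefficient of t^m gets multiplied by m
θtL : Laurent → Laurent
θtL (mkL k p) = mkL k (weightP (ℤ.- (+ k)) p)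

-- R = (ℚ[t,t⁻¹])[[x]] : a power series is its sequence of x-coefficients

R : Set
R = ℕ → Laurent

_≈_ : R → R → Set
f ≈ g = ∀ (n : ℕ) → f n ≈L g n

infix 4 _≈_ _≈L_
infixl 6 _+R_
infixl 7 _*R_

0R : R
0R _ = 0L

cR : ℚ → R
cR c zero    = constL c
cR c (suc _) = 0L

_+R_ : R → R → R
(f +R g) n = f n +L g n

_·R_ : ℚ → R → R
(c ·R f) n = scaleL c (f n)
infixl 7 _·R_

sumTo : ℕ → (ℕ → Laurent) → Laurent
sumTo zero    h = h zero
sumTo (suc n) h = sumTo n h +L h (suc n)

_*R_ : R → R → R
(f *R g) n = sumTo n (λ i → f i *L g (n ∸ i))

xR : R → R
xR f zero    = 0L
xR f (suc n) = f n

tR : R → R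
tR f n = tL (f n)

θt : R → R
θt f n = θtL (f n)

θx : R → R
θx f n = scaleL (ℕtoℚ n) (f n)

lin : ℚ → ℚ → ℚ → R → R
lin a b c f = (a ·R f) +R (b ·R θt f) +R (c ·R θx f)

q : ℤ → ℚ
q = ℤtoℚ

D-L : R → R
D-L W = q (+ 4) ·R tR (xR (lin (q (+ 1)) (q (+ 1)) (q (+ 1)) (lin (q (+ 2)) (q (ℤ.- + 3)) (q (+ 1)) W)))

D-R : R → R
D-R W = lin (q (+ 0)) (q (+ 3)) (q (+ 1)) (lin (q (ℤ.- + 2)) (q (+ 3)) (q (+ 1)) W)

D̃-L : R → R
D̃-L W = q (+ 4) ·R xR (lin (q (+ 1)) (q (ℤ.- + 1)) (q (+ 1)) (lin (q (+ 0)) (q (+ 3)) (q (+ 1)) W))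

D̃-R : R → R
D̃-R W = tR (lin (q (+ 2)) (q (ℤ.- + 3)) (q (+ 1)) (lin (q (+ 0)) (q (ℤ.- + 3)) (q (+ 1)) W))

oneR : R
oneR = cR 1ℚ

algLHS : R → R
algLHS W =
  tR (oneR +R tR (xR oneR))
  +R (q (ℤ.- + 1) ·R tR W)
  +R (q (+ 2) ·R tR (xR (xR (W *R W))))
  +R xR (xR (xR (W *R W *R W *R W)))

IsSolution : R → Set
IsSolution W = algLHS W ≈ 0R

Congruent1+tx : R → Set
Congruent1+tx W = (W 0 ≈L constL 1ℚ) × (W 1 ≈L tL (constL 1ℚ))
  where open import Data.Product using (_×_)

module Submission where

-- Proposition 5.5.  P(W) = t(1+tx) − tW + 2tx²W² + x³W⁴ over ℚ[t,t⁻¹][[x]]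
-- has ∂P/∂W = −t + x·(…), a unit; so P has a unique root W, the x-adic limit
-- of iterating Φ(W) = W + P(W)/t, and W ≡ 1 + tx (mod x²).  For the PDEs,
-- polynomial certificates show that (∂P/∂W)³·(D_L W − D_R W) lies in the
-- ideal generated by P(W) and its θt-, θx-derivatives (likewise for D̃).

open import Algebra using (CommutativeRing)

module IntegerRingSolver {c ℓ} (A : CommutativeRing c ℓ) where
  open import Data.Nat as ℕ using (ℕ; zero; suc)
  open import Data.Integer as ℤ using (ℤ; +_; -[1+_]; _⊖_; ∣_∣; sign; _◃_)
  import Data.Integer.Properties as ℤP
  open import Data.Maybe using (just; nothing)
  open import Data.Sign as Sign using (Sign)
  import Relation.Binary.PropositionalEquality as ≡
  open import Relation.Binary.Definitions using (WeaklyDecidable)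
  open import Relation.Nullary using (yes; no)
  open import Algebra.Solver.Ring.AlmostCommutativeRing
    using (_-Raw-AlmostCommutative⟶_; Induced-equivalence; fromCommutativeRing)

  open CommutativeRing A
  open import Algebra.Properties.Semiring.Mult semiring using (_×_; ×-homo-+; ×1-homo-*)
  open import Algebra.Properties.Ring ring using (-‿distribˡ-*; -‿involutive; -‿+-comm; -0#≈0#)
  open import Algebra.Properties.CommutativeSemigroup *-commutativeSemigroup using (interchange)
  open import Relation.Binary.Reasoning.Setoid setoid

  fromℕ : ℕ → Carrier
  fromℕ n = n × 1#

  fromℤ : ℤ → Carrier
  fromℤ (+ n)    = fromℕ n
  fromℤ -[1+ n ] = - fromℕ (suc n)

  private
    σ : Sign → Carrier
    σ Sign.+ = 1#
    σ Sign.- = - 1#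

    σ-* : ∀ s s′ → σ (s Sign.* s′) ≈ σ s * σ s′
    σ-* Sign.- Sign.- = sym (begin
      - 1# * - 1#   ≈⟨ -‿distribˡ-* 1# (- 1#) ⟨
      - (1# * - 1#) ≈⟨ -‿cong (*-identityˡ (- 1#)) ⟩
      - - 1#        ≈⟨ -‿involutive 1# ⟩
      1#            ∎)
    σ-* Sign.- Sign.+ = sym (*-identityʳ _)
    σ-* Sign.+ Sign.- = sym (*-identityˡ _)
    σ-* Sign.+ Sign.+ = sym (*-identityˡ _)

    fromℤ-◃ : ∀ s n → fromℤ (s ◃ n) ≈ σ s * fromℕ n
    fromℤ-◃ s      zero    = sym (zeroʳ _)
    fromℤ-◃ Sign.+ (suc n) = sym (*-identityˡ _)
    fromℤ-◃ Sign.- (suc n) = trans (-‿cong (sym (*-identityˡ _))) (-‿distribˡ-* 1# _)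

  fromℤ-* : ∀ i j → fromℤ (i ℤ.* j) ≈ fromℤ i * fromℤ j
  fromℤ-* i j = begin
    fromℤ (sign i Sign.* sign j ◃ ∣ i ∣ ℕ.* ∣ j ∣)           ≈⟨ fromℤ-◃ (sign i Sign.* sign j) (∣ i ∣ ℕ.* ∣ j ∣) ⟩
    σ (sign i Sign.* sign j) * fromℕ (∣ i ∣ ℕ.* ∣ j ∣)      ≈⟨ *-cong (σ-* (sign i) (sign j)) (×1-homo-* ∣ i ∣ ∣ j ∣) ⟩
    (σ (sign i) * σ (sign j)) * (fromℕ ∣ i ∣ * fromℕ ∣ j ∣) ≈⟨ interchange _ _ _ _ ⟩
    (σ (sign i) * fromℕ ∣ i ∣) * (σ (sign j) * fromℕ ∣ j ∣) ≈⟨ *-cong (fromℤ-sign-abs i) (fromℤ-sign-abs j) ⟨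
    fromℤ i * fromℤ j                                       ∎
    where
    fromℤ-sign-abs : ∀ k → fromℤ k ≈ σ (sign k) * fromℕ ∣ k ∣
    fromℤ-sign-abs k = trans (reflexive (≡.cong fromℤ (≡.sym (ℤP.◃-inverse k)))) (fromℤ-◃ (sign k) ∣ k ∣)

  fromℤ-⊖ : ∀ m n → fromℤ (m ⊖ n) ≈ fromℕ m - fromℕ n
  fromℤ-⊖ zero    zero    = sym (trans (+-congˡ -0#≈0#) (+-identityʳ _))
  fromℤ-⊖ zero    (suc n) = sym (+-identityˡ _)
  fromℤ-⊖ (suc m) zero    = sym (trans (+-congˡ -0#≈0#) (+-identityʳ _))
  fromℤ-⊖ (suc m) (suc n) = begin
    fromℤ (suc m ⊖ suc n)           ≡⟨ ≡.cong fromℤ (ℤP.[1+m]⊖[1+n]≡m⊖n m n) ⟩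
    fromℤ (m ⊖ n)                   ≈⟨ fromℤ-⊖ m n ⟩
    fromℕ m - fromℕ n               ≈⟨ +-identityˡ _ ⟨
    0# + (fromℕ m - fromℕ n)        ≈⟨ +-congʳ (-‿inverseʳ 1#) ⟨
    (1# - 1#) + (fromℕ m - fromℕ n) ≈⟨ regroup ⟩
    (1# + fromℕ m) - (1# + fromℕ n) ∎
    where
    regroup : (1# - 1#) + (fromℕ m - fromℕ n) ≈ (1# + fromℕ m) - (1# + fromℕ n)
    regroup = begin
      (1# - 1#) + (fromℕ m - fromℕ n)   ≈⟨ +-assoc 1# (- 1#) _ ⟩
      1# + (- 1# + (fromℕ m - fromℕ n)) ≈⟨ +-congˡ (+-assoc (- 1#) (fromℕ m) (- fromℕ n)) ⟨
      1# + ((- 1# + fromℕ m) - fromℕ n) ≈⟨ +-congˡ (+-congʳ (+-comm (- 1#) (fromℕ m))) ⟩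
      1# + ((fromℕ m - 1#) - fromℕ n)   ≈⟨ +-congˡ (+-assoc (fromℕ m) (- 1#) (- fromℕ n)) ⟩
      1# + (fromℕ m + (- 1# - fromℕ n)) ≈⟨ +-congˡ (+-congˡ (-‿+-comm 1# (fromℕ n))) ⟩
      1# + (fromℕ m - (1# + fromℕ n))   ≈⟨ +-assoc 1# (fromℕ m) _ ⟨
      (1# + fromℕ m) - (1# + fromℕ n)   ∎

  fromℤ-+ : ∀ i j → fromℤ (i ℤ.+ j) ≈ fromℤ i + fromℤ j
  fromℤ-+ -[1+ m ] -[1+ n ] = begin
    - fromℕ (suc (suc (m ℕ.+ n)))      ≈⟨ -‿cong (+-congˡ (×-homo-+ 1# (suc m) n)) ⟩
    - (1# + (fromℕ (suc m) + fromℕ n)) ≈⟨ -‿cong (+-congˡ (+-comm _ _)) ⟩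
    - (1# + (fromℕ n + fromℕ (suc m))) ≈⟨ -‿cong (+-assoc 1# _ _) ⟨
    - (fromℕ (suc n) + fromℕ (suc m))  ≈⟨ -‿+-comm _ _ ⟨
    - fromℕ (suc n) - fromℕ (suc m)    ≈⟨ +-comm _ _ ⟩
    - fromℕ (suc m) - fromℕ (suc n)    ∎
  fromℤ-+ -[1+ m ] (+ n)    = trans (fromℤ-⊖ n (suc m)) (+-comm _ _)
  fromℤ-+ (+ m)    -[1+ n ] = fromℤ-⊖ m (suc n)
  fromℤ-+ (+ m)    (+ n)    = ×-homo-+ 1# m n

  fromℤ-neg : ∀ i → fromℤ (ℤ.- i) ≈ - fromℤ i
  fromℤ-neg -[1+ n ]    = sym (-‿involutive _)
  fromℤ-neg (+ zero)    = sym -0#≈0#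
  fromℤ-neg (+ (suc n)) = refl

  fromℤ-morphism : CommutativeRing.rawRing ℤP.+-*-commutativeRing -Raw-AlmostCommutative⟶ fromCommutativeRing A
  fromℤ-morphism = record
    { ⟦_⟧ = fromℤ ; +-homo = fromℤ-+ ; *-homo = fromℤ-* ; -‿homo = fromℤ-neg ; 0-homo = refl ; 1-homo = +-identityʳ 1# }

  -- the solver only needs to recognise syntactically equal coefficients
  fromℤ-equal? : WeaklyDecidable (Induced-equivalence fromℤ-morphism)
  fromℤ-equal? i j with i ℤ.≟ j
  ... | yes ≡.refl = just refl
  ... | no _       = nothing

  open import Algebra.Solver.Ring (CommutativeRing.rawRing ℤP.+-*-commutativeRing)
    (fromCommutativeRing A) fromℤ-morphism fromℤ-equal? public
    using (Polynomial; op; [+]; [*]; con; var; _:+_; _:*_; _:^_; :-_; ⟦_⟧; ⟦_⟧↓; prove)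

module Derivations {c ℓ} (A : CommutativeRing c ℓ) where
  open import Level using (_⊔_)
  open import Data.Nat as ℕ using (ℕ; zero; suc)
  open import Data.Integer using (+_; -[1+_])
  open import Data.Fin using (Fin)
  open import Data.Vec using (Vec; lookup)
  open import Relation.Binary.PropositionalEquality as ≡ using (_≡_)

  open CommutativeRing A
  open IntegerRingSolver A
  open import Algebra.Properties.Ring ring using (-0#≈0#; x+x≈x⇒x≈0)
  open import Algebra.Properties.Group +-group using (inverseˡ-unique)
  open import Algebra.Properties.Semiring.Exp semiring using (^-congˡ)

  record IsDerivation (δ : Carrier → Carrier) : Set (c ⊔ ℓ) where
    field
      δ-cong    : ∀ {a b} → a ≈ b → δ a ≈ δ b
      δ-+       : ∀ a b → δ (a + b) ≈ δ a + δ b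
      δ-leibniz : ∀ a b → δ (a * b) ≈ δ a * b + a * δ b

  module Derivation {δ : Carrier → Carrier} (isδ : IsDerivation δ) where
    open IsDerivation isδ public

    δ-0 : δ 0# ≈ 0#
    δ-0 = x+x≈x⇒x≈0 (δ 0#) (sym (trans (δ-cong (sym (+-identityˡ 0#))) (δ-+ 0# 0#)))

    δ-1 : δ 1# ≈ 0#
    δ-1 = x+x≈x⇒x≈0 (δ 1#) (sym (trans (δ-cong (sym (*-identityˡ 1#)))
                                       (trans (δ-leibniz 1# 1#) (+-cong (*-identityʳ _) (*-identityˡ _)))))

    δ-neg : ∀ a → δ (- a) ≈ - δ a
    δ-neg a = inverseˡ-unique (δ (- a)) (δ a) (trans (sym (δ-+ (- a) a)) (trans (δ-cong (-‿inverseˡ a)) δ-0))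

    δ-fromℕ : ∀ n → δ (fromℕ n) ≈ 0#
    δ-fromℕ zero    = δ-0
    δ-fromℕ (suc n) = trans (δ-+ 1# (fromℕ n)) (trans (+-cong δ-1 (δ-fromℕ n)) (+-identityˡ 0#))

    δ-fromℤ : ∀ z → δ (fromℤ z) ≈ 0#
    δ-fromℤ (+ n)    = δ-fromℕ n
    δ-fromℤ -[1+ n ] = trans (δ-neg _) (trans (-‿cong (δ-fromℕ (suc n))) -0#≈0#)

  rename : ∀ {m n} → (Fin m → Fin n) → Polynomial m → Polynomial n
  rename f (op o p q) = op o (rename f p) (rename f q)
  rename f (con k)    = con k
  rename f (var i)    = var (f i)
  rename f (p :^ k)   = rename f p :^ k
  rename f (:- p)     = :- rename f p

  ∂pow : ∀ {n} → Polynomial n → Polynomial n → ℕ → Polynomial n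
  ∂pow p dp zero    = con (+ 0)
  ∂pow p dp (suc k) = dp :* p :^ k :+ p :* ∂pow p dp k

  -- formal derivative: variable i is sent to f i and has derivative d i
  ∂ : ∀ {m n} → (Fin m → Fin n) → (Fin m → Polynomial n) → Polynomial m → Polynomial n
  ∂ f d (op [+] p q) = ∂ f d p :+ ∂ f d q
  ∂ f d (op [*] p q) = ∂ f d p :* rename f q :+ rename f p :* ∂ f d q
  ∂ f d (con k)      = con (+ 0)
  ∂ f d (var i)      = d i
  ∂ f d (p :^ k)     = ∂pow (rename f p) (∂ f d p) k
  ∂ f d (:- p)       = :- ∂ f d p

  module Embedding {m n} (f : Fin m → Fin n) (ρ : Vec Carrier m) (ρ′ : Vec Carrier n)
                   (f-ρ : ∀ i → lookup ρ′ (f i) ≡ lookup ρ i) where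

    rename-sound : ∀ p → ⟦ rename f p ⟧ ρ′ ≈ ⟦ p ⟧ ρ
    rename-sound (op [+] p q) = +-cong (rename-sound p) (rename-sound q)
    rename-sound (op [*] p q) = *-cong (rename-sound p) (rename-sound q)
    rename-sound (con k)      = refl
    rename-sound (var i)      = reflexive (f-ρ i)
    rename-sound (p :^ k)     = ^-congˡ k (rename-sound p)
    rename-sound (:- p)       = -‿cong (rename-sound p)

    module _ {δ} (isδ : IsDerivation δ) (d : Fin m → Polynomial n)
             (d-ρ : ∀ i → δ (lookup ρ i) ≈ ⟦ d i ⟧ ρ′) where
      open Derivation isδ

      ∂-sound    : ∀ p → δ (⟦ p ⟧ ρ) ≈ ⟦ ∂ f d p ⟧ ρ′
      ∂pow-sound : ∀ p k → δ (⟦ p :^ k ⟧ ρ) ≈ ⟦ ∂pow (rename f p) (∂ f d p) k ⟧ ρ′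
      ∂-sound (op [+] p q) = trans (δ-+ _ _) (+-cong (∂-sound p) (∂-sound q))
      ∂-sound (op [*] p q) = trans (δ-leibniz _ _)
        (+-cong (*-cong (∂-sound p) (sym (rename-sound q))) (*-cong (sym (rename-sound p)) (∂-sound q)))
      ∂-sound (con k)      = δ-fromℤ k
      ∂-sound (var i)      = d-ρ i
      ∂-sound (p :^ k)     = ∂pow-sound p k
      ∂-sound (:- p)       = trans (δ-neg _) (-‿cong (∂-sound p))
      ∂pow-sound p zero    = δ-1
      ∂pow-sound p (suc k) = trans (δ-leibniz _ _)
        (+-cong (*-cong (∂-sound p) (sym (rename-sound (p :^ k)))) (*-cong (sym (rename-sound p)) (∂pow-sound p k)))

      ∂-vanishes : ∀ p → ⟦ p ⟧ ρ ≈ 0# → ⟦ ∂ f d p ⟧ ρ′ ≈ 0#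
      ∂-vanishes p p≈0 = trans (sym (∂-sound p)) (trans (δ-cong p≈0) δ-0)

-- The latter makes
-- lists into the truncated ring A[x]/(xᴺ) in which x is nilpotent.
module CoefficientLists {c ℓ} (A : CommutativeRing c ℓ) where
  open import Data.Nat as ℕ using (ℕ; zero; suc; _∸_; _≤_; _<_; z≤n; s≤s)
  import Data.Nat.Properties as ℕP
  open import Data.Integer using (+_; -[1+_])
  open import Data.List using (List; []; _∷_; map)
  open import Data.Product using (_,_)
  open import Function using (_∘_)
  import Relation.Binary.PropositionalEquality as ≡
  open import Relation.Binary.Structures using (IsEquivalence)

  open CommutativeRing A hiding (zero)
  open import Relation.Binary.Reasoning.Setoid setoid
  open import Algebra.Properties.CommutativeSemigroup +-commutativeSemigroup using (interchange)
  open import Algebra.Properties.Semiring.Mult semiring using (×-homo-+)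
  open import Algebra.Properties.Ring ring using (-0#≈0#)
  open IntegerRingSolver A using (fromℕ; fromℤ)
  open Derivations using (IsDerivation; module Derivation)

  Poly : Set c
  Poly = List Carrier

  infixl 6 _+ₚ_
  infixl 7 _*ₚ_ _·ₚ_
  infix  8 -ₚ_

  coeff : ℕ → Poly → Carrier
  coeff _       []      = 0#
  coeff zero    (a ∷ p) = a
  coeff (suc i) (a ∷ p) = coeff i p

  _+ₚ_ : Poly → Poly → Poly
  []      +ₚ q       = q
  (a ∷ p) +ₚ []      = a ∷ p
  (a ∷ p) +ₚ (b ∷ q) = (a + b) ∷ (p +ₚ q)

  -ₚ_ : Poly → Poly
  -ₚ_ = map (λ a → - a)

  _·ₚ_ : Carrier → Poly → Poly
  a ·ₚ p = map (a *_) p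

  _*ₚ_ : Poly → Poly → Poly
  []      *ₚ q = []
  (a ∷ p) *ₚ q = a ·ₚ q +ₚ (0# ∷ p *ₚ q)

  -- the Euler operator x d/dx, shifted: the i-th coefficient gets weight k + i
  weight : ℕ → Poly → Poly
  weight k []      = []
  weight k (a ∷ p) = fromℕ k * a ∷ weight (suc k) p

  sum≤ : ℕ → (ℕ → Carrier) → Carrier
  sum≤ zero    h = h zero
  sum≤ (suc n) h = sum≤ n h + h (suc n)

  infix 4 _≐_ _≈[_]_
  record _≐_ (p q : Poly) : Set ℓ where
    constructor coeffwise
    field coeff-≐ : ∀ i → coeff i p ≈ coeff i q
  open _≐_ public

  record _≈[_]_ (p : Poly) (N : ℕ) (q : Poly) : Set ℓ where
    constructor below
    field coeff-≈ : ∀ i → i < N → coeff i p ≈ coeff i q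
  open _≈[_]_ public

  ≐⇒≈[ : ∀ {p q} N → p ≐ q → p ≈[ N ] q
  ≐⇒≈[ N e = below λ i _ → coeff-≐ e i

  ≐-refl : ∀ {p} → p ≐ p
  ≐-refl = coeffwise λ i → refl

  ≐-sym : ∀ {p q} → p ≐ q → q ≐ p
  ≐-sym e = coeffwise λ i → sym (coeff-≐ e i)

  ≐-trans : ∀ {p q r} → p ≐ q → q ≐ r → p ≐ r
  ≐-trans e f = coeffwise λ i → trans (coeff-≐ e i) (coeff-≐ f i)

  ≈[]-refl : ∀ {p N} → p ≈[ N ] p
  ≈[]-refl = below λ i _ → refl

  ≈[]-sym : ∀ {p q N} → p ≈[ N ] q → q ≈[ N ] p
  ≈[]-sym e = below λ i i<N → sym (coeff-≈ e i i<N)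

  ≈[]-trans : ∀ {p q r N} → p ≈[ N ] q → q ≈[ N ] r → p ≈[ N ] r
  ≈[]-trans e f = below λ i i<N → trans (coeff-≈ e i i<N) (coeff-≈ f i i<N)

  ≈[]-mono : ∀ {p q M N} → M ≤ N → p ≈[ N ] q → p ≈[ M ] q
  ≈[]-mono M≤N e = below λ i i<M → coeff-≈ e i (ℕP.<-≤-trans i<M M≤N)

  ∷-cong : ∀ {a b p q} → a ≈ b → p ≐ q → (a ∷ p) ≐ (b ∷ q)
  ∷-cong {a} {b} {p} {q} e f = coeffwise go
    where
    go : ∀ i → coeff i (a ∷ p) ≈ coeff i (b ∷ q)
    go zero    = e
    go (suc i) = coeff-≐ f i

  single-cong : ∀ {N a b} → a ≈ b → (a ∷ []) ≈[ N ] (b ∷ [])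
  single-cong {N} {a} {b} a≈b = below go
    where
    go : ∀ i → i < N → coeff i (a ∷ []) ≈ coeff i (b ∷ [])
    go zero    _ = a≈b
    go (suc i) _ = refl

  coeff-+ : ∀ i p q → coeff i (p +ₚ q) ≈ coeff i p + coeff i q
  coeff-+ i       []      q       = sym (+-identityˡ _)
  coeff-+ i       (a ∷ p) []      = sym (+-identityʳ _)
  coeff-+ zero    (a ∷ p) (b ∷ q) = refl
  coeff-+ (suc i) (a ∷ p) (b ∷ q) = coeff-+ i p q

  coeff-map : ∀ (g : Carrier → Carrier) → g 0# ≈ 0# → ∀ i p → coeff i (map g p) ≈ g (coeff i p)
  coeff-map g g0 i       []      = sym g0
  coeff-map g g0 zero    (a ∷ p) = refl
  coeff-map g g0 (suc i) (a ∷ p) = coeff-map g g0 i p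

  coeff-neg : ∀ i p → coeff i (-ₚ p) ≈ - coeff i p
  coeff-neg = coeff-map -_ -0#≈0#

  coeff-· : ∀ i a p → coeff i (a ·ₚ p) ≈ a * coeff i p
  coeff-· i a = coeff-map (a *_) (zeroʳ a) i

  coeff-weight : ∀ i k p → coeff i (weight k p) ≈ fromℕ (k ℕ.+ i) * coeff i p
  coeff-weight i       k []      = sym (zeroʳ _)
  coeff-weight zero    k (a ∷ p) = *-congʳ (reflexive (≡.cong fromℕ (≡.sym (ℕP.+-identityʳ k))))
  coeff-weight (suc i) k (a ∷ p) =
    trans (coeff-weight i (suc k) p) (*-congʳ (reflexive (≡.cong fromℕ (≡.sym (ℕP.+-suc k i)))))

  sum≤-cong : ∀ n {h h′} → (∀ j → j ≤ n → h j ≈ h′ j) → sum≤ n h ≈ sum≤ n h′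
  sum≤-cong zero    e = e 0 z≤n
  sum≤-cong (suc n) e = +-cong (sum≤-cong n (λ j j≤n → e j (ℕP.m≤n⇒m≤1+n j≤n))) (e (suc n) ℕP.≤-refl)

  sum≤-+ : ∀ n h h′ → sum≤ n (λ j → h j + h′ j) ≈ sum≤ n h + sum≤ n h′
  sum≤-+ zero    h h′ = refl
  sum≤-+ (suc n) h h′ = trans (+-congʳ (sum≤-+ n h h′)) (interchange _ _ _ _)

  sum≤-*ˡ : ∀ n a h → sum≤ n (λ j → a * h j) ≈ a * sum≤ n h
  sum≤-*ˡ zero    a h = refl
  sum≤-*ˡ (suc n) a h = trans (+-congʳ (sum≤-*ˡ n a h)) (sym (distribˡ _ _ _))

  sum≤-0 : ∀ n h → (∀ j → h j ≈ 0#) → sum≤ n h ≈ 0#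
  sum≤-0 zero    h e = e 0
  sum≤-0 (suc n) h e = trans (+-cong (sum≤-0 n h e) (e (suc n))) (+-identityˡ 0#)

  sum≤-peel : ∀ n h → sum≤ (suc n) h ≈ h 0 + sum≤ n (h ∘ suc)
  sum≤-peel zero    h = refl
  sum≤-peel (suc n) h = trans (+-congʳ (sum≤-peel n h)) (+-assoc _ _ _)

  sum≤-reverse : ∀ n h → sum≤ n h ≈ sum≤ n (λ j → h (n ∸ j))
  sum≤-reverse zero    h = refl
  sum≤-reverse (suc n) h = begin
    sum≤ n h + h (suc n)                   ≈⟨ +-comm _ _ ⟩
    h (suc n) + sum≤ n h                   ≈⟨ +-congˡ (sum≤-reverse n h) ⟩
    h (suc n) + sum≤ n (λ j → h (n ∸ j))   ≈⟨ sum≤-peel n (λ j → h (suc n ∸ j)) ⟨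
    sum≤ (suc n) (λ j → h (suc n ∸ j))     ∎

  coeff-* : ∀ i p q → coeff i (p *ₚ q) ≈ sum≤ i (λ j → coeff j p * coeff (i ∸ j) q)
  coeff-* i       []      q = sym (sum≤-0 i _ (λ j → zeroˡ _))
  coeff-* zero    (a ∷ p) q =
    trans (coeff-+ 0 (a ·ₚ q) (0# ∷ p *ₚ q)) (trans (+-congʳ (coeff-· 0 a q)) (+-identityʳ _))
  coeff-* (suc i) (a ∷ p) q = begin
    coeff (suc i) (a ·ₚ q +ₚ (0# ∷ p *ₚ q))                   ≈⟨ coeff-+ (suc i) (a ·ₚ q) (0# ∷ p *ₚ q) ⟩
    coeff (suc i) (a ·ₚ q) + coeff i (p *ₚ q)                 ≈⟨ +-cong (coeff-· (suc i) a q) (coeff-* i p q) ⟩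
    a * coeff (suc i) q + sum≤ i (λ j → coeff j p * coeff (i ∸ j) q) ≈⟨ sum≤-peel i _ ⟨
    sum≤ (suc i) (λ j → coeff j (a ∷ p) * coeff (suc i ∸ j) q) ∎

  *ₚ-cong-below : ∀ {N p p′ q q′} → p ≈[ N ] p′ → q ≈[ N ] q′ → p *ₚ q ≈[ N ] p′ *ₚ q′
  *ₚ-cong-below {N} {p} {p′} {q} {q′} e f = below λ i i<N → begin
    coeff i (p *ₚ q)                                 ≈⟨ coeff-* i p q ⟩
    sum≤ i (λ j → coeff j p * coeff (i ∸ j) q)       ≈⟨ sum≤-cong i (λ j j≤i → *-cong
                                                          (coeff-≈ e j (ℕP.≤-<-trans j≤i i<N))
                                                          (coeff-≈ f (i ∸ j) (ℕP.≤-<-trans (ℕP.m∸n≤m i j) i<N))) ⟩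
    sum≤ i (λ j → coeff j p′ * coeff (i ∸ j) q′)     ≈⟨ coeff-* i p′ q′ ⟨
    coeff i (p′ *ₚ q′)                               ∎

  *ₚ-cong : ∀ {p p′ q q′} → p ≐ p′ → q ≐ q′ → p *ₚ q ≐ p′ *ₚ q′
  *ₚ-cong {p} {p′} {q} {q′} e f = coeffwise λ i →
    coeff-≈ (*ₚ-cong-below {suc i} {p} {p′} {q} {q′} (≐⇒≈[ (suc i) e) (≐⇒≈[ (suc i) f)) i (ℕP.n<1+n i)

  +ₚ-cong-below : ∀ {N p p′ q q′} → p ≈[ N ] p′ → q ≈[ N ] q′ → p +ₚ q ≈[ N ] p′ +ₚ q′
  +ₚ-cong-below {N} {p} {p′} {q} {q′} e f = below λ i i<N →
    trans (coeff-+ i p q) (trans (+-cong (coeff-≈ e i i<N) (coeff-≈ f i i<N)) (sym (coeff-+ i p′ q′)))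

  +ₚ-cong : ∀ {p p′ q q′} → p ≐ p′ → q ≐ q′ → p +ₚ q ≐ p′ +ₚ q′
  +ₚ-cong {p} {p′} {q} {q′} e f = coeffwise λ i →
    trans (coeff-+ i p q) (trans (+-cong (coeff-≐ e i) (coeff-≐ f i)) (sym (coeff-+ i p′ q′)))

  -ₚ-cong-below : ∀ {N p p′} → p ≈[ N ] p′ → -ₚ p ≈[ N ] -ₚ p′
  -ₚ-cong-below {N} {p} {p′} e = below λ i i<N →
    trans (coeff-neg i p) (trans (-‿cong (coeff-≈ e i i<N)) (sym (coeff-neg i p′)))

  +ₚ-comm : ∀ p q → p +ₚ q ≐ q +ₚ p
  +ₚ-comm p q = coeffwise λ i → trans (coeff-+ i p q) (trans (+-comm _ _) (sym (coeff-+ i q p)))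

  +ₚ-assoc : ∀ p q r → (p +ₚ q) +ₚ r ≐ p +ₚ (q +ₚ r)
  +ₚ-assoc p q r = coeffwise λ i → begin
    coeff i ((p +ₚ q) +ₚ r)               ≈⟨ coeff-+ i (p +ₚ q) r ⟩
    coeff i (p +ₚ q) + coeff i r          ≈⟨ +-congʳ (coeff-+ i p q) ⟩
    (coeff i p + coeff i q) + coeff i r   ≈⟨ +-assoc _ _ _ ⟩
    coeff i p + (coeff i q + coeff i r)   ≈⟨ +-congˡ (coeff-+ i q r) ⟨
    coeff i p + coeff i (q +ₚ r)          ≈⟨ coeff-+ i p (q +ₚ r) ⟨
    coeff i (p +ₚ (q +ₚ r))               ∎

  +ₚ-identityʳ : ∀ p → p +ₚ [] ≐ p
  +ₚ-identityʳ p = coeffwise λ i → trans (coeff-+ i p []) (+-identityʳ _)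

  +ₚ-inverseˡ : ∀ p → -ₚ p +ₚ p ≐ []
  +ₚ-inverseˡ p = coeffwise λ i → trans (coeff-+ i (-ₚ p) p) (trans (+-congʳ (coeff-neg i p)) (-‿inverseˡ _))

  +ₚ-inverseʳ : ∀ p → p +ₚ -ₚ p ≐ []
  +ₚ-inverseʳ p = ≐-trans (+ₚ-comm p (-ₚ p)) (+ₚ-inverseˡ p)

  *ₚ-comm : ∀ p q → p *ₚ q ≐ q *ₚ p
  *ₚ-comm p q = coeffwise λ i → begin
    coeff i (p *ₚ q)                                           ≈⟨ coeff-* i p q ⟩
    sum≤ i (λ j → coeff j p * coeff (i ∸ j) q)                 ≈⟨ sum≤-reverse i _ ⟩
    sum≤ i (λ j → coeff (i ∸ j) p * coeff (i ∸ (i ∸ j)) q)     ≈⟨ sum≤-cong i (λ j j≤i → trans (*-comm _ _)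
                                                                    (*-congʳ (reflexive (≡.cong (λ k → coeff k q) (ℕP.m∸[m∸n]≡n j≤i))))) ⟩
    sum≤ i (λ j → coeff j q * coeff (i ∸ j) p)                 ≈⟨ coeff-* i q p ⟨
    coeff i (q *ₚ p)                                           ∎

  *ₚ-distribʳ : ∀ p p′ r → (p +ₚ p′) *ₚ r ≐ p *ₚ r +ₚ p′ *ₚ r
  *ₚ-distribʳ p p′ r = coeffwise λ i → begin
    coeff i ((p +ₚ p′) *ₚ r)                          ≈⟨ coeff-* i (p +ₚ p′) r ⟩
    sum≤ i (λ j → coeff j (p +ₚ p′) * coeff (i ∸ j) r) ≈⟨ sum≤-cong i (λ j _ → trans (*-congʳ (coeff-+ j p p′)) (distribʳ _ _ _)) ⟩
    sum≤ i (λ j → coeff j p * coeff (i ∸ j) r + coeff j p′ * coeff (i ∸ j) r) ≈⟨ sum≤-+ i _ _ ⟩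
    sum≤ i (λ j → coeff j p * coeff (i ∸ j) r) + sum≤ i (λ j → coeff j p′ * coeff (i ∸ j) r)
                                                      ≈⟨ +-cong (coeff-* i p r) (coeff-* i p′ r) ⟨
    coeff i (p *ₚ r) + coeff i (p′ *ₚ r)              ≈⟨ coeff-+ i (p *ₚ r) (p′ *ₚ r) ⟨
    coeff i (p *ₚ r +ₚ p′ *ₚ r)                       ∎

  *ₚ-distribˡ : ∀ r p p′ → r *ₚ (p +ₚ p′) ≐ r *ₚ p +ₚ r *ₚ p′
  *ₚ-distribˡ r p p′ = ≐-trans (*ₚ-comm r (p +ₚ p′))
    (≐-trans (*ₚ-distribʳ p p′ r) (+ₚ-cong (*ₚ-comm p r) (*ₚ-comm p′ r)))

  ·ₚ-*ₚ : ∀ a q r → (a ·ₚ q) *ₚ r ≐ a ·ₚ (q *ₚ r)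
  ·ₚ-*ₚ a q r = coeffwise λ i → begin
    coeff i ((a ·ₚ q) *ₚ r)                           ≈⟨ coeff-* i (a ·ₚ q) r ⟩
    sum≤ i (λ j → coeff j (a ·ₚ q) * coeff (i ∸ j) r)  ≈⟨ sum≤-cong i (λ j _ → trans (*-congʳ (coeff-· j a q)) (*-assoc _ _ _)) ⟩
    sum≤ i (λ j → a * (coeff j q * coeff (i ∸ j) r))  ≈⟨ sum≤-*ˡ i a _ ⟩
    a * sum≤ i (λ j → coeff j q * coeff (i ∸ j) r)    ≈⟨ *-congˡ (coeff-* i q r) ⟨
    a * coeff i (q *ₚ r)                              ≈⟨ coeff-· i a (q *ₚ r) ⟨
    coeff i (a ·ₚ (q *ₚ r))                           ∎

  0∷-*ₚ : ∀ s r → (0# ∷ s) *ₚ r ≐ (0# ∷ s *ₚ r)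
  0∷-*ₚ s r = coeffwise go
    where
    go : ∀ i → coeff i ((0# ∷ s) *ₚ r) ≈ coeff i (0# ∷ s *ₚ r)
    go zero    = trans (coeff-+ 0 (0# ·ₚ r) (0# ∷ s *ₚ r))
                       (trans (+-congʳ (trans (coeff-· 0 0# r) (zeroˡ _))) (+-identityʳ _))
    go (suc i) = trans (coeff-+ (suc i) (0# ·ₚ r) (0# ∷ s *ₚ r))
                       (trans (+-congʳ (trans (coeff-· (suc i) 0# r) (zeroˡ _))) (+-identityˡ _))

  *ₚ-assoc : ∀ p q r → (p *ₚ q) *ₚ r ≐ p *ₚ (q *ₚ r)
  *ₚ-assoc []      q r = ≐-refl
  *ₚ-assoc (a ∷ p) q r = ≐-trans (*ₚ-distribʳ (a ·ₚ q) (0# ∷ p *ₚ q) r)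
    (+ₚ-cong (·ₚ-*ₚ a q r) (≐-trans (0∷-*ₚ (p *ₚ q) r) (∷-cong refl (*ₚ-assoc p q r))))

  single-*ₚ : ∀ a q → (a ∷ []) *ₚ q ≐ a ·ₚ q
  single-*ₚ a q = coeffwise λ i → trans (coeff-+ i (a ·ₚ q) (0# ∷ [])) (trans (+-congˡ (zero-list i)) (+-identityʳ _))
    where
    zero-list : ∀ i → coeff i (0# ∷ []) ≈ 0#
    zero-list zero    = refl
    zero-list (suc i) = refl

  coeff-single-* : ∀ i a q → coeff i ((a ∷ []) *ₚ q) ≈ a * coeff i q
  coeff-single-* i a q = trans (coeff-≐ (single-*ₚ a q) i) (coeff-· i a q)

  *ₚ-identityˡ : ∀ q → (1# ∷ []) *ₚ q ≐ q
  *ₚ-identityˡ q = ≐-trans (single-*ₚ 1# q) (coeffwise λ i → trans (coeff-· i 1# q) (*-identityˡ _))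

  Truncated : ℕ → CommutativeRing c ℓ
  Truncated N = record
    { Carrier = Poly ; _≈_ = _≈[ N ]_ ; _+_ = _+ₚ_ ; _*_ = _*ₚ_ ; -_ = -ₚ_ ; 0# = [] ; 1# = 1# ∷ []
    ; isCommutativeRing = record
      { isRing = record
        { +-isAbelianGroup = record
          { isGroup = record
            { isMonoid = record
              { isSemigroup = record
                { isMagma = record { isEquivalence = ≈[]-isEquivalence ; ∙-cong = +ₚ-cong-below }
                ; assoc = λ p q r → ≐⇒≈[ N (+ₚ-assoc p q r) }
              ; identity = (λ p → ≈[]-refl) , (λ p → ≐⇒≈[ N (+ₚ-identityʳ p)) }
            ; inverse = (λ p → ≐⇒≈[ N (+ₚ-inverseˡ p)) , (λ p → ≐⇒≈[ N (+ₚ-inverseʳ p))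
            ; ⁻¹-cong = -ₚ-cong-below }
          ; comm = λ p q → ≐⇒≈[ N (+ₚ-comm p q) }
        ; *-cong = *ₚ-cong-below
        ; *-assoc = λ p q r → ≐⇒≈[ N (*ₚ-assoc p q r)
        ; *-identity = (λ p → ≐⇒≈[ N (*ₚ-identityˡ p))
                     , (λ p → ≐⇒≈[ N (≐-trans (*ₚ-comm p _) (*ₚ-identityˡ p)))
        ; distrib = (λ r p p′ → ≐⇒≈[ N (*ₚ-distribˡ r p p′)) , (λ r p p′ → ≐⇒≈[ N (*ₚ-distribʳ p p′ r)) }
      ; *-comm = λ p q → ≐⇒≈[ N (*ₚ-comm p q) } }
    where
    ≈[]-isEquivalence : IsEquivalence _≈[ N ]_
    ≈[]-isEquivalence = record { refl = ≈[]-refl ; sym = ≈[]-sym ; trans = ≈[]-trans }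

  X : Poly
  X = 0# ∷ 1# ∷ []

  X-*ₚ : ∀ s → X *ₚ s ≐ (0# ∷ s)
  X-*ₚ s = ≐-trans (0∷-*ₚ (1# ∷ []) s) (∷-cong refl (*ₚ-identityˡ s))

  X-multiple : ∀ a u → coeff 0 ((a ∷ []) *ₚ (X *ₚ u)) ≈ 0#
  X-multiple a u = trans (coeff-single-* 0 a (X *ₚ u)) (trans (*-congˡ (coeff-≐ (X-*ₚ u) 0)) (zeroʳ a))

  X-*ₚ-lift : ∀ {k u v} → u ≈[ k ] v → X *ₚ u ≈[ suc k ] X *ₚ v
  X-*ₚ-lift {k} {u} {v} e = below go
    where
    go : ∀ i → i < suc k → coeff i (X *ₚ u) ≈ coeff i (X *ₚ v)
    go zero    _         = trans (coeff-≐ (X-*ₚ u) 0) (sym (coeff-≐ (X-*ₚ v) 0))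
    go (suc i) (s≤s i<k) = trans (coeff-≐ (X-*ₚ u) (suc i)) (trans (coeff-≈ e i i<k) (sym (coeff-≐ (X-*ₚ v) (suc i))))

  module _ (N : ℕ) where
    open Derivations (Truncated N) using () renaming (IsDerivation to IsDerivationₙ)
    open import Algebra.Properties.Semiring.Exp (CommutativeRing.semiring (Truncated N)) using (_^_)

    X-nilpotent : X ^ N ≈[ N ] []
    X-nilpotent = below (go N)
      where
      go : ∀ k i → i < k → coeff i (X ^ k) ≈ 0#
      go (suc k) zero    _         = coeff-≐ (X-*ₚ (X ^ k)) 0
      go (suc k) (suc i) (s≤s i<k) = trans (coeff-≐ (X-*ₚ (X ^ k)) (suc i)) (go k i i<k)

    map-derivation : ∀ {D} → IsDerivation A D → IsDerivationₙ (map D)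
    map-derivation {D} isD = record
      { δ-cong = λ {p} {q} e → below λ i i<N → trans (coeff-D i p) (trans (δ-cong (coeff-≈ e i i<N)) (sym (coeff-D i q)))
      ; δ-+ = λ p q → ≐⇒≈[ N (coeffwise λ i → trans (coeff-D i (p +ₚ q)) (trans (δ-cong (coeff-+ i p q)) (trans (δ-+ _ _)
                 (sym (trans (coeff-+ i (map D p) (map D q)) (+-cong (coeff-D i p) (coeff-D i q)))))))
      ; δ-leibniz = λ p q → ≐⇒≈[ N (leibniz p q) }
      where
      open Derivation A isD
      coeff-D : ∀ i p → coeff i (map D p) ≈ D (coeff i p)
      coeff-D = coeff-map D δ-0
      D-sum≤ : ∀ n h → D (sum≤ n h) ≈ sum≤ n (λ j → D (h j))
      D-sum≤ zero    h = refl
      D-sum≤ (suc n) h = trans (δ-+ _ _) (+-congʳ (D-sum≤ n h))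
      leibniz : ∀ p q → map D (p *ₚ q) ≐ map D p *ₚ q +ₚ p *ₚ map D q
      leibniz p q = coeffwise λ i → begin
        coeff i (map D (p *ₚ q))                                ≈⟨ coeff-D i (p *ₚ q) ⟩
        D (coeff i (p *ₚ q))                                    ≈⟨ δ-cong (coeff-* i p q) ⟩
        D (sum≤ i (λ j → coeff j p * coeff (i ∸ j) q))          ≈⟨ D-sum≤ i _ ⟩
        sum≤ i (λ j → D (coeff j p * coeff (i ∸ j) q))          ≈⟨ sum≤-cong i (λ j _ → trans (δ-leibniz _ _)
                                                                     (+-cong (*-congʳ (sym (coeff-D j p))) (*-congˡ (sym (coeff-D (i ∸ j) q))))) ⟩
        sum≤ i (λ j → coeff j (map D p) * coeff (i ∸ j) q + coeff j p * coeff (i ∸ j) (map D q))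
                                                                ≈⟨ sum≤-+ i _ _ ⟩
        sum≤ i (λ j → coeff j (map D p) * coeff (i ∸ j) q) + sum≤ i (λ j → coeff j p * coeff (i ∸ j) (map D q))
                                                                ≈⟨ +-cong (coeff-* i (map D p) q) (coeff-* i p (map D q)) ⟨
        coeff i (map D p *ₚ q) + coeff i (p *ₚ map D q)         ≈⟨ coeff-+ i (map D p *ₚ q) (p *ₚ map D q) ⟨
        coeff i (map D p *ₚ q +ₚ p *ₚ map D q)                  ∎

    euler-derivation : IsDerivationₙ (weight 0)
    euler-derivation = record
      { δ-cong = λ {p} {q} e → below λ i i<N → trans (coeff-weight i 0 p) (trans (*-congˡ (coeff-≈ e i i<N)) (sym (coeff-weight i 0 q)))
      ; δ-+ = λ p q → ≐⇒≈[ N (coeffwise λ i → trans (coeff-weight i 0 (p +ₚ q)) (trans (*-congˡ (coeff-+ i p q)) (trans (distribˡ _ _ _)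
                 (sym (trans (coeff-+ i (weight 0 p) (weight 0 q)) (+-cong (coeff-weight i 0 p) (coeff-weight i 0 q)))))))
      ; δ-leibniz = λ p q → ≐⇒≈[ N (leibniz p q) }
      where
      -- i = j + (i - j) splits the weight of a term of the Cauchy product
      split : ∀ i j {a b} → j ≤ i → fromℕ i * (a * b) ≈ (fromℕ j * a) * b + a * (fromℕ (i ∸ j) * b)
      split i j {a} {b} j≤i = begin
        fromℕ i * (a * b)                            ≈⟨ *-congʳ (reflexive (≡.cong fromℕ (≡.sym (ℕP.m+[n∸m]≡n j≤i)))) ⟩
        fromℕ (j ℕ.+ (i ∸ j)) * (a * b)              ≈⟨ *-congʳ (×-homo-+ 1# j (i ∸ j)) ⟩
        (fromℕ j + fromℕ (i ∸ j)) * (a * b)             ≈⟨ distribʳ _ _ _ ⟩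
        fromℕ j * (a * b) + fromℕ (i ∸ j) * (a * b)     ≈⟨ +-cong (sym (*-assoc _ _ _)) (x∙yz≈y∙xz _ a b) ⟩
        (fromℕ j * a) * b + a * (fromℕ (i ∸ j) * b)     ∎
        where open import Algebra.Properties.CommutativeSemigroup *-commutativeSemigroup using (x∙yz≈y∙xz)
      leibniz : ∀ p q → weight 0 (p *ₚ q) ≐ weight 0 p *ₚ q +ₚ p *ₚ weight 0 q
      leibniz p q = coeffwise λ i → begin
        coeff i (weight 0 (p *ₚ q))                              ≈⟨ coeff-weight i 0 (p *ₚ q) ⟩
        fromℕ i * coeff i (p *ₚ q)                                  ≈⟨ *-congˡ (coeff-* i p q) ⟩
        fromℕ i * sum≤ i (λ j → coeff j p * coeff (i ∸ j) q)        ≈⟨ sum≤-*ˡ i _ _ ⟨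
        sum≤ i (λ j → fromℕ i * (coeff j p * coeff (i ∸ j) q))      ≈⟨ sum≤-cong i (λ j j≤i → trans (split i j j≤i)
                                                                      (sym (+-cong (*-congʳ (coeff-weight j 0 p)) (*-congˡ (coeff-weight (i ∸ j) 0 q))))) ⟩
        sum≤ i (λ j → coeff j (weight 0 p) * coeff (i ∸ j) q + coeff j p * coeff (i ∸ j) (weight 0 q))
                                                                 ≈⟨ sum≤-+ i _ _ ⟩
        sum≤ i (λ j → coeff j (weight 0 p) * coeff (i ∸ j) q) + sum≤ i (λ j → coeff j p * coeff (i ∸ j) (weight 0 q))
                                                                 ≈⟨ +-cong (coeff-* i (weight 0 p) q) (coeff-* i p (weight 0 q)) ⟨
        coeff i (weight 0 p *ₚ q) + coeff i (p *ₚ weight 0 q)    ≈⟨ coeff-+ i (weight 0 p *ₚ q) (p *ₚ weight 0 q) ⟨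
        coeff i (weight 0 p *ₚ q +ₚ p *ₚ weight 0 q)             ∎

    map-euler-comm : ∀ {D} → IsDerivation A D → ∀ p → map D (weight 0 p) ≈[ N ] weight 0 (map D p)
    map-euler-comm {D} isD p = below λ i _ → begin
      coeff i (map D (weight 0 p))         ≈⟨ coeff-map D δ-0 i (weight 0 p) ⟩
      D (coeff i (weight 0 p))             ≈⟨ δ-cong (coeff-weight i 0 p) ⟩
      D (fromℕ i * coeff i p)                 ≈⟨ δ-leibniz _ _ ⟩
      D (fromℕ i) * coeff i p + fromℕ i * D (coeff i p) ≈⟨ +-congʳ (trans (*-congʳ (δ-fromℤ (+ i))) (zeroˡ _)) ⟩
      0# + fromℕ i * D (coeff i p)            ≈⟨ +-identityˡ _ ⟩
      fromℕ i * D (coeff i p)                 ≈⟨ *-congˡ (coeff-map D δ-0 i p) ⟨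
      fromℕ i * coeff i (map D p)             ≈⟨ coeff-weight i 0 (map D p) ⟨
      coeff i (weight 0 (map D p))         ∎
      where open Derivation A isD

    fromℤ-constant : ∀ z → IntegerRingSolver.fromℤ (Truncated N) z ≈[ N ] (fromℤ z ∷ [])
    fromℤ-constant (+ n)    = naturals n
      where
      naturals : ∀ n → IntegerRingSolver.fromℕ (Truncated N) n ≈[ N ] (fromℕ n ∷ [])
      naturals zero    = below λ { zero _ → refl ; (suc i) _ → refl }
      naturals (suc n) = +ₚ-cong-below {N} {1# ∷ []} {1# ∷ []} ≈[]-refl (naturals n)
    fromℤ-constant -[1+ n ] = -ₚ-cong-below (fromℤ-constant (+ suc n))

-- Its derivative in W is
-- −t + x·(…), a unit; this gives uniqueness of roots, and (after
-- multiplying by a power of it) lets us eliminate derivatives of W in the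
-- differential operators, proving the two PDEs for any root W.
module AlgebraicEquation {s ℓ} (S : CommutativeRing s ℓ) where
  open import Data.Nat as ℕ using (ℕ; zero; suc)
  open import Data.Integer as ℤ using (ℤ; +_; -[1+_])
  open import Data.Fin using (Fin; _↑ˡ_; #_) renaming (zero to f0; suc to fs)
  open import Data.Vec using (Vec; []; _∷_; _++_; lookup)
  open import Data.Vec.Properties using (lookup-++ˡ)

  open CommutativeRing S
  open IntegerRingSolver S
  open Derivations S
  open import Algebra.Properties.Semiring.Exp semiring using (_^_)
  open import Algebra.Properties.CommutativeSemiring.Exp commutativeSemiring using (^-distrib-*)
  open import Algebra.Properties.Ring ring using (-0#≈0#; x[y-z]≈xy-xz; [y-z]x≈yx-zx)
  open import Algebra.Properties.Group +-group using (x∙y⁻¹≈ε⇒x≈y)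
  open import Algebra.Properties.CommutativeSemigroup *-commutativeSemigroup using (x∙yz≈y∙xz)
  open import Relation.Binary.Reasoning.Setoid setoid

  equation : ∀ {n} → Polynomial n → Polynomial n → Polynomial n → Polynomial n
  equation t x w = t :* (con (+ 1) :+ t :* (x :* con (+ 1))) :+ con -[1+ 0 ] :* (t :* w)
                   :+ con (+ 2) :* (t :* (x :* (x :* (w :* w)))) :+ x :* (x :* (x :* (((w :* w) :* w) :* w)))

  -- 1 + y + … + y^(n-1), an inverse of 1 − y when y is nilpotent
  geometric : Carrier → ℕ → Carrier
  geometric y zero    = 0#
  geometric y (suc n) = 1# + y * geometric y n

  geometric-sum : ∀ y n → (1# - y) * geometric y n ≈ 1# - y ^ n
  geometric-sum y zero    = trans (zeroʳ _) (sym (-‿inverseʳ 1#))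
  geometric-sum y (suc n) = begin
    (1# - y) * (1# + y * g)            ≈⟨ distribˡ (1# - y) 1# (y * g) ⟩
    (1# - y) * 1# + (1# - y) * (y * g) ≈⟨ +-cong (*-identityʳ _) (x∙yz≈y∙xz (1# - y) y g) ⟩
    (1# - y) + y * ((1# - y) * g)      ≈⟨ +-congˡ (*-congˡ (geometric-sum y n)) ⟩
    (1# - y) + y * (1# - y ^ n)        ≈⟨ +-congˡ (trans (x[y-z]≈xy-xz y 1# (y ^ n)) (+-congʳ (*-identityʳ y))) ⟩
    (1# - y) + (y - y * y ^ n)         ≈⟨ +-assoc 1# (- y) _ ⟩
    1# + (- y + (y - y * y ^ n))       ≈⟨ +-congˡ (+-assoc (- y) y _) ⟨
    1# + ((- y + y) - y * y ^ n)       ≈⟨ +-congˡ (trans (+-congʳ (-‿inverseˡ y)) (+-identityˡ _)) ⟩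
    1# - y * y ^ n                     ∎
    where g = geometric y n

  module Equation (T X T⁻¹ : Carrier) (T-inverse : T * T⁻¹ ≈ 1#) (N : ℕ) (X-nilpotent : X ^ N ≈ 0#) where

    -- −T + X·G is a unit: its inverse is −T⁻¹(1 + Y + … + Y^(N−1)) with Y = X·G·T⁻¹
    unit-cancel : ∀ G h → (- T + X * G) * h ≈ 0# → h ≈ 0#
    unit-cancel G h uh≈0 = begin
      h                            ≈⟨ *-identityˡ h ⟨
      1# * h                       ≈⟨ *-congʳ inverse ⟨
      (v * (- T + X * G)) * h      ≈⟨ *-assoc _ _ _ ⟩
      v * ((- T + X * G) * h)      ≈⟨ *-congˡ uh≈0 ⟩
      v * 0#                       ≈⟨ zeroʳ v ⟩
      0#                           ∎
      where
      Y = X * (G * T⁻¹)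
      g = geometric Y N
      v = - (T⁻¹ * g)
      t x γ t⁻¹ σ : Polynomial 5
      t = var (# 0) ; x = var (# 1) ; γ = var (# 2) ; t⁻¹ = var (# 3) ; σ = var (# 4)
      Y-nilpotent : Y ^ N ≈ 0#
      Y-nilpotent = trans (^-distrib-* X (G * T⁻¹) N) (trans (*-congʳ X-nilpotent) (zeroˡ _))
      inverse : v * (- T + X * G) ≈ 1#
      inverse = begin
        v * (- T + X * G)            ≈⟨ prove (T ∷ X ∷ G ∷ T⁻¹ ∷ g ∷ [])
                                          (:- (t⁻¹ :* σ) :* (:- t :+ x :* γ))
                                          ((t :* t⁻¹) :* σ :+ :- ((x :* (γ :* t⁻¹)) :* σ)) refl ⟩
        (T * T⁻¹) * g - Y * g        ≈⟨ +-congʳ (trans (*-congʳ T-inverse) (*-identityˡ g)) ⟩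
        g - Y * g                    ≈⟨ +-congʳ (*-identityˡ g) ⟨
        1# * g - Y * g               ≈⟨ [y-z]x≈yx-zx g 1# Y ⟨
        (1# - Y) * g                 ≈⟨ geometric-sum Y N ⟩
        1# - Y ^ N                   ≈⟨ +-congˡ (trans (-‿cong Y-nilpotent) -0#≈0#) ⟩
        1# + 0#                      ≈⟨ +-identityʳ 1# ⟩
        1#                           ∎

    P : Carrier → Carrier
    P w = ⟦ equation (var (# 0)) (var (# 1)) (var (# 2)) ⟧ (T ∷ X ∷ w ∷ [])

    -- Φ(a) = a + P(a)/T; the roots of P are the fixed points of Φ
    Φ : Carrier → Carrier
    Φ a = (fromℤ (+ 1) + T * X) + X * (fromℤ (+ 2) * (X * (a * a)) + T⁻¹ * (X * (X * (((a * a) * a) * a))))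

    P-fixed-point : ∀ a → P a ≈ T * (Φ a - a)
    P-fixed-point a = begin
      P a                             ≈⟨ prove ρ (equation t x w) (rest :+ top) refl ⟩
      ⟦ rest :+ top ⟧ ρ               ≈⟨ +-congˡ (trans (*-congʳ T-inverse) (*-identityˡ _)) ⟨
      ⟦ rest :+ (t :* t⁻¹) :* top ⟧ ρ ≈⟨ prove ρ (rest :+ (t :* t⁻¹) :* top) (t :* (φ :+ :- w)) refl ⟩
      T * (Φ a - a)                   ∎
      where
      ρ = T ∷ X ∷ a ∷ T⁻¹ ∷ []
      t x w t⁻¹ rest top φ : Polynomial 4
      t = var (# 0) ; x = var (# 1) ; w = var (# 2) ; t⁻¹ = var (# 3)
      rest = t :+ t :* t :* x :+ con (+ 2) :* t :* x :* x :* w :* w :+ :- (t :* w)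
      top  = x :* x :* x :* w :* w :* w :* w
      φ    = (con (+ 1) :+ t :* x) :+ x :* (con (+ 2) :* (x :* (w :* w)) :+ t⁻¹ :* (x :* (x :* (((w :* w) :* w) :* w))))

    -- two roots differ by a unit multiple of their difference, hence agree
    root-unique : ∀ a b → P a ≈ 0# → P b ≈ 0# → a ≈ b
    root-unique a b Pa≈0 Pb≈0 = x∙y⁻¹≈ε⇒x≈y a b (unit-cancel (⟦ g ⟧ ρ) (a - b) (begin
      (- T + X * ⟦ g ⟧ ρ) * (a - b) ≈⟨ prove ρ ((:- t :+ x :* g) :* (w₁ :+ :- w₂)) (equation t x w₁ :+ :- equation t x w₂) refl ⟩
      P a - P b                     ≈⟨ +-cong Pa≈0 (-‿cong Pb≈0) ⟩
      0# - 0#                       ≈⟨ -‿inverseʳ 0# ⟩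
      0#                            ∎))
      where
      ρ = T ∷ X ∷ a ∷ b ∷ []
      t x w₁ w₂ g : Polynomial 4
      t = var (# 0) ; x = var (# 1) ; w₁ = var (# 2) ; w₂ = var (# 3)
      g  = con (+ 2) :* t :* x :* (w₁ :+ w₂) :+ x :* x :* (w₁ :+ w₂) :* (w₁ :* w₁ :+ w₂ :* w₂)

    module Differential {θt θx : Carrier → Carrier} (θt-derivation : IsDerivation θt) (θx-derivation : IsDerivation θx)
             (θ-comm : ∀ a → θt (θx a) ≈ θx (θt a))
             (θt-T : θt T ≈ T) (θx-T : θx T ≈ 0#) (θt-X : θt X ≈ 0#) (θx-X : θx X ≈ X) where
      ℒ : ℤ → ℤ → ℤ → Carrier → Carrier
      ℒ a b c f = (fromℤ a * f + fromℤ b * θt f) + fromℤ c * θx f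

      DL DR D̃L D̃R : Carrier → Carrier
      DL W = fromℤ (+ 4) * (T * (X * ℒ (+ 1) (+ 1) (+ 1) (ℒ (+ 2) -[1+ 2 ] (+ 1) W)))
      DR W = ℒ (+ 0) (+ 3) (+ 1) (ℒ -[1+ 1 ] (+ 3) (+ 1) W)
      D̃L W = fromℤ (+ 4) * (X * ℒ (+ 1) -[1+ 0 ] (+ 1) (ℒ (+ 0) (+ 3) (+ 1) W))
      D̃R W = T * ℒ (+ 2) -[1+ 2 ] (+ 1) (ℒ (+ 0) -[1+ 2 ] (+ 1) W)

      -- Syntax.  Contexts: (t, x, W) ⊂ (t, x, W, U, V) ⊂ (t, x, W, U, V, Utt, Utx, Vxx),
      -- standing for U = θt W, V = θx W, Utt = θt U, Utx = θx U, Vxx = θx V.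
      vt vx vW vU vV vUtt vUtx vVxx : Polynomial 8
      vt = var (# 0) ; vx = var (# 1) ; vW = var (# 2) ; vU = var (# 3)
      vV = var (# 4) ; vUtt = var (# 5) ; vUtx = var (# 6) ; vVxx = var (# 7)

      0ₚ : ∀ {n} → Polynomial n
      0ₚ = con (+ 0)

      P₃ : Polynomial 3
      P₃ = equation (var (# 0)) (var (# 1)) (var (# 2))

      ∂t₀ ∂x₀ : Fin 3 → Polynomial 5
      ∂t₀ = lookup (var (# 0) ∷ 0ₚ ∷ var (# 3) ∷ [])
      ∂x₀ = lookup (0ₚ ∷ var (# 1) ∷ var (# 4) ∷ [])

      ∂t₁ ∂x₁ : Fin 5 → Polynomial 8
      ∂t₁ = lookup (vt ∷ 0ₚ ∷ vU ∷ vUtt ∷ vUtx ∷ [])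
      ∂x₁ = lookup (0ₚ ∷ vx ∷ vV ∷ vUtx ∷ vVxx ∷ [])

      Rt Rx : Polynomial 5
      Rt = ∂ (_↑ˡ 2) ∂t₀ P₃
      Rx = ∂ (_↑ˡ 2) ∂x₀ P₃

      Rtt Rtx Rxx : Polynomial 8
      Rtt = ∂ (_↑ˡ 3) ∂t₁ Rt
      Rtx = ∂ (_↑ˡ 3) ∂x₁ Rt
      Rxx = ∂ (_↑ˡ 3) ∂x₁ Rx

      ℒWₚ : ℤ → ℤ → ℤ → Polynomial 5
      ℒWₚ a b c = (con a :* var (# 2) :+ con b :* var (# 3)) :+ con c :* var (# 4)

      ℒₚ : ℤ → ℤ → ℤ → Polynomial 5 → Polynomial 8
      ℒₚ a b c e = (con a :* rename (_↑ˡ 3) e :+ con b :* ∂ (_↑ˡ 3) ∂t₁ e) :+ con c :* ∂ (_↑ˡ 3) ∂x₁ e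

      DLₚ DRₚ D̃Lₚ D̃Rₚ : Polynomial 8
      DLₚ = con (+ 4) :* (vt :* (vx :* ℒₚ (+ 1) (+ 1) (+ 1) (ℒWₚ (+ 2) -[1+ 2 ] (+ 1))))
      DRₚ = ℒₚ (+ 0) (+ 3) (+ 1) (ℒWₚ -[1+ 1 ] (+ 3) (+ 1))
      D̃Lₚ = con (+ 4) :* (vx :* ℒₚ (+ 1) -[1+ 0 ] (+ 1) (ℒWₚ (+ 0) (+ 3) (+ 1)))
      D̃Rₚ = vt :* ℒₚ (+ 2) -[1+ 2 ] (+ 1) (ℒWₚ (+ 0) -[1+ 2 ] (+ 1))

      -- Q = ∂P/∂W = −t + x·G
      Q G : Polynomial 8
      Q = (con (+ 4) :* (vx :^ 3) :* (vW :^ 3)) :+ (con -[1+ 0 ] :* vt) :+ (con (+ 4) :* vt :* (vx :^ 2) :* vW)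
      G = (con (+ 4) :* (vx :^ 2) :* (vW :^ 3)) :+ (con (+ 4) :* vt :* vx :* vW)

      -- Data certifying that E vanishes at every root W:
      --   Q·E  = E′ + a·Rtt + b·Rtx + c·Rxx   (eliminates second derivatives)
      --   Q²E′ = F + K·Rt + L·Rx              (eliminates first derivatives)
      --   F    = M·P
      record Certificate : Set where
        field a b c E′ F K L M : Polynomial 8

      module AtRoot (W : Carrier) (PW≈0 : P W ≈ 0#) where
        ρ₀ : Vec Carrier 3
        ρ₀ = T ∷ X ∷ W ∷ []
        ρ₁ : Vec Carrier 5
        ρ₁ = ρ₀ ++ θt W ∷ θx W ∷ []
        ρ₂ : Vec Carrier 8
        ρ₂ = ρ₁ ++ θt (θt W) ∷ θx (θt W) ∷ θx (θx W) ∷ []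

        ∂t₀-sound : ∀ i → θt (lookup ρ₀ i) ≈ ⟦ ∂t₀ i ⟧ ρ₁
        ∂t₀-sound f0           = θt-T
        ∂t₀-sound (fs f0)      = θt-X
        ∂t₀-sound (fs (fs f0)) = refl

        ∂x₀-sound : ∀ i → θx (lookup ρ₀ i) ≈ ⟦ ∂x₀ i ⟧ ρ₁
        ∂x₀-sound f0           = θx-T
        ∂x₀-sound (fs f0)      = θx-X
        ∂x₀-sound (fs (fs f0)) = refl

        ∂t₁-sound : ∀ i → θt (lookup ρ₁ i) ≈ ⟦ ∂t₁ i ⟧ ρ₂
        ∂t₁-sound f0                     = θt-T
        ∂t₁-sound (fs f0)                = θt-X
        ∂t₁-sound (fs (fs f0))           = refl
        ∂t₁-sound (fs (fs (fs f0)))      = refl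
        ∂t₁-sound (fs (fs (fs (fs f0)))) = θ-comm W

        ∂x₁-sound : ∀ i → θx (lookup ρ₁ i) ≈ ⟦ ∂x₁ i ⟧ ρ₂
        ∂x₁-sound f0                     = θx-T
        ∂x₁-sound (fs f0)                = θx-X
        ∂x₁-sound (fs (fs f0))           = refl
        ∂x₁-sound (fs (fs (fs f0)))      = refl
        ∂x₁-sound (fs (fs (fs (fs f0)))) = refl

        module E₀ = Embedding (_↑ˡ 2) ρ₀ ρ₁ (lookup-++ˡ ρ₀ _)
        module E₁ = Embedding (_↑ˡ 3) ρ₁ ρ₂ (lookup-++ˡ ρ₁ _)

        Rt≈0 : ⟦ Rt ⟧ ρ₁ ≈ 0#
        Rt≈0 = E₀.∂-vanishes θt-derivation ∂t₀ ∂t₀-sound P₃ PW≈0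
        Rx≈0 : ⟦ Rx ⟧ ρ₁ ≈ 0#
        Rx≈0 = E₀.∂-vanishes θx-derivation ∂x₀ ∂x₀-sound P₃ PW≈0
        Rtt≈0 : ⟦ Rtt ⟧ ρ₂ ≈ 0#
        Rtt≈0 = E₁.∂-vanishes θt-derivation ∂t₁ ∂t₁-sound Rt Rt≈0
        Rtx≈0 : ⟦ Rtx ⟧ ρ₂ ≈ 0#
        Rtx≈0 = E₁.∂-vanishes θx-derivation ∂x₁ ∂x₁-sound Rt Rt≈0
        Rxx≈0 : ⟦ Rxx ⟧ ρ₂ ≈ 0#
        Rxx≈0 = E₁.∂-vanishes θx-derivation ∂x₁ ∂x₁-sound Rx Rx≈0

        ℒₚ-sound : ∀ a b c a′ b′ c′ → ℒ a b c (ℒ a′ b′ c′ W) ≈ ⟦ ℒₚ a b c (ℒWₚ a′ b′ c′) ⟧ ρ₂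
        ℒₚ-sound a b c a′ b′ c′ = +-cong (+-cong
          (*-congˡ (sym (E₁.rename-sound (ℒWₚ a′ b′ c′))))
          (*-congˡ (E₁.∂-sound θt-derivation ∂t₁ ∂t₁-sound (ℒWₚ a′ b′ c′))))
          (*-congˡ (E₁.∂-sound θx-derivation ∂x₁ ∂x₁-sound (ℒWₚ a′ b′ c′)))

        -- the three identities are checked by normalisation (the solver's ⟦_⟧↓)
        certified : ∀ E (C : Certificate) → let open Certificate C in
          ⟦ Q :* E ⟧↓ ρ₂ ≈ ⟦ E′ :+ (a :* Rtt :+ b :* Rtx :+ c :* Rxx) ⟧↓ ρ₂ →
          ⟦ Q :* (Q :* E′) ⟧↓ ρ₂ ≈ ⟦ F :+ (K :* rename (_↑ˡ 3) Rt :+ L :* rename (_↑ˡ 3) Rx) ⟧↓ ρ₂ →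
          ⟦ F ⟧↓ ρ₂ ≈ ⟦ M :* equation vt vx vW ⟧↓ ρ₂ →
          ⟦ E ⟧ ρ₂ ≈ 0#
        certified E C second-order↓ first-order↓ zeroth-order↓ =
          cancel (⟦ E ⟧ ρ₂) (cancel (q * ⟦ E ⟧ ρ₂) (cancel (q * (q * ⟦ E ⟧ ρ₂)) Q³E≈0))
          where
          open Certificate C
          second-order = prove ρ₂ (Q :* E) (E′ :+ (a :* Rtt :+ b :* Rtx :+ c :* Rxx)) second-order↓
          first-order  = prove ρ₂ (Q :* (Q :* E′)) (F :+ (K :* rename (_↑ˡ 3) Rt :+ L :* rename (_↑ˡ 3) Rx)) first-order↓
          zeroth-order = prove ρ₂ F (M :* equation vt vx vW) zeroth-order↓
          q = ⟦ Q ⟧ ρ₂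
          q≈unit : q ≈ - T + X * ⟦ G ⟧ ρ₂
          q≈unit = prove ρ₂ Q (:- vt :+ vx :* G) refl
          cancel : ∀ h → q * h ≈ 0# → h ≈ 0#
          cancel h qh≈0 = unit-cancel (⟦ G ⟧ ρ₂) h (trans (*-congʳ (sym q≈unit)) qh≈0)
          z+0 : ∀ {z u} → u ≈ 0# → z + u ≈ z
          z+0 u≈0 = trans (+-congˡ u≈0) (+-identityʳ _)
          a·0 : ∀ {a u} → u ≈ 0# → a * u ≈ 0#
          a·0 u≈0 = trans (*-congˡ u≈0) (zeroʳ _)
          QE≈E′ : q * ⟦ E ⟧ ρ₂ ≈ ⟦ E′ ⟧ ρ₂
          QE≈E′ = trans second-order (z+0 (trans (+-cong (trans (+-cong (a·0 Rtt≈0) (a·0 Rtx≈0)) (+-identityˡ 0#))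
                                                         (a·0 Rxx≈0))
                                                 (+-identityˡ 0#)))
          Q²E′≈F : q * (q * ⟦ E′ ⟧ ρ₂) ≈ ⟦ F ⟧ ρ₂
          Q²E′≈F = trans first-order (z+0 (trans (+-cong (a·0 (trans (E₁.rename-sound Rt) Rt≈0))
                                                        (a·0 (trans (E₁.rename-sound Rx) Rx≈0))) (+-identityˡ 0#)))
          Q³E≈0 : q * (q * (q * ⟦ E ⟧ ρ₂)) ≈ 0#
          Q³E≈0 = trans (*-congˡ (*-congˡ QE≈E′)) (trans Q²E′≈F (trans zeroth-order (a·0 PW≈0)))


      first-certificate : Certificate
      first-certificate = record
        { a  = (((con -[1+ 8 ])) :+ ((con -[1+ 11 ]) :* vt :* vx))
        ; b  = (((con -[1+ 5 ])) :+ ((con -[1+ 7 ]) :* vt :* vx))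
        ; c  = (((con -[1+ 0 ])) :+ ((con (+ 4)) :* vt :* vx))
        ; E′ = (((con (+ 12)) :* (vx :^ 3) :* (vW :^ 2) :* (vV :^ 2))
               :+ ((con (+ 72)) :* (vx :^ 3) :* (vW :^ 2) :* vU :* vV)
               :+ ((con (+ 108)) :* (vx :^ 3) :* (vW :^ 2) :* (vU :^ 2))
               :+ ((con (+ 32)) :* (vx :^ 3) :* (vW :^ 3) :* vV)
               :+ ((con (+ 96)) :* (vx :^ 3) :* (vW :^ 3) :* vU) :+ ((con (+ 9)) :* (vx :^ 3) :* (vW :^ 4))
               :+ ((con (+ 9)) :* vt) :+ ((con -[1+ 7 ]) :* vt :* vV) :+ ((con -[1+ 23 ]) :* vt :* vU)
               :+ ((con -[1+ 8 ]) :* vt :* vW) :+ ((con (+ 4)) :* vt :* (vx :^ 2) :* (vV :^ 2))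
               :+ ((con (+ 24)) :* vt :* (vx :^ 2) :* vU :* vV)
               :+ ((con (+ 36)) :* vt :* (vx :^ 2) :* (vU :^ 2))
               :+ ((con (+ 48)) :* vt :* (vx :^ 2) :* vW :* vV)
               :+ ((con (+ 144)) :* vt :* (vx :^ 2) :* vW :* vU)
               :+ ((con (+ 50)) :* vt :* (vx :^ 2) :* (vW :^ 2))
               :+ ((con -[1+ 47 ]) :* vt :* (vx :^ 4) :* (vW :^ 2) :* (vV :^ 2))
               :+ ((con (+ 96)) :* vt :* (vx :^ 4) :* (vW :^ 2) :* vU :* vV)
               :+ ((con (+ 144)) :* vt :* (vx :^ 4) :* (vW :^ 2) :* (vU :^ 2))
               :+ ((con -[1+ 47 ]) :* vt :* (vx :^ 4) :* (vW :^ 3) :* vV)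
               :+ ((con (+ 80)) :* vt :* (vx :^ 4) :* (vW :^ 3) :* vU)
               :+ ((con -[1+ 3 ]) :* vt :* (vx :^ 4) :* (vW :^ 4)) :+ ((con (+ 61)) :* (vt :^ 2) :* vx)
               :+ ((con -[1+ 19 ]) :* (vt :^ 2) :* vx :* vV) :+ ((con -[1+ 19 ]) :* (vt :^ 2) :* vx :* vU)
               :+ ((con -[1+ 19 ]) :* (vt :^ 2) :* vx :* vW)
               :+ ((con -[1+ 15 ]) :* (vt :^ 2) :* (vx :^ 3) :* (vV :^ 2))
               :+ ((con (+ 32)) :* (vt :^ 2) :* (vx :^ 3) :* vU :* vV)
               :+ ((con (+ 48)) :* (vt :^ 2) :* (vx :^ 3) :* (vU :^ 2))
               :+ ((con (+ 16)) :* (vt :^ 2) :* (vx :^ 3) :* vW :* vV)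
               :+ ((con (+ 144)) :* (vt :^ 2) :* (vx :^ 3) :* vW :* vU)
               :+ ((con (+ 56)) :* (vt :^ 2) :* (vx :^ 3) :* (vW :^ 2))
               :+ ((con (+ 60)) :* (vt :^ 3) :* (vx :^ 2)))
        ; F  = (((con -[1+ 131 ]) :* (vx :^ 9) :* (vW :^ 10))
               :+ ((con -[1+ 23 ]) :* vt :* (vx :^ 6) :* (vW :^ 6))
               :+ ((con (+ 144)) :* vt :* (vx :^ 6) :* (vW :^ 7))
               :+ ((con -[1+ 395 ]) :* vt :* (vx :^ 8) :* (vW :^ 8))
               :+ ((con (+ 80)) :* vt :* (vx :^ 10) :* (vW :^ 10))
               :+ ((con (+ 108)) :* (vt :^ 2) :* (vx :^ 3) :* (vW :^ 2))
               :+ ((con -[1+ 95 ]) :* (vt :^ 2) :* (vx :^ 3) :* (vW :^ 3))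
               :+ ((con -[1+ 26 ]) :* (vt :^ 2) :* (vx :^ 3) :* (vW :^ 4))
               :+ ((con (+ 120)) :* (vt :^ 2) :* (vx :^ 5) :* (vW :^ 4))
               :+ ((con (+ 288)) :* (vt :^ 2) :* (vx :^ 5) :* (vW :^ 5))
               :+ ((con -[1+ 39 ]) :* (vt :^ 2) :* (vx :^ 7) :* (vW :^ 6))
               :+ ((con -[1+ 159 ]) :* (vt :^ 2) :* (vx :^ 7) :* (vW :^ 7))
               :+ ((con (+ 560)) :* (vt :^ 2) :* (vx :^ 9) :* (vW :^ 8)) :+ ((con -[1+ 14 ]) :* (vt :^ 3))
               :+ ((con (+ 15)) :* (vt :^ 3) :* vW) :+ ((con (+ 36)) :* (vt :^ 3) :* (vx :^ 2))
               :+ ((con (+ 96)) :* (vt :^ 3) :* (vx :^ 2) :* vW)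
               :+ ((con -[1+ 161 ]) :* (vt :^ 3) :* (vx :^ 2) :* (vW :^ 2))
               :+ ((con (+ 456)) :* (vt :^ 3) :* (vx :^ 4) :* (vW :^ 2))
               :+ ((con -[1+ 79 ]) :* (vt :^ 3) :* (vx :^ 4) :* (vW :^ 3))
               :+ ((con (+ 80)) :* (vt :^ 3) :* (vx :^ 4) :* (vW :^ 4))
               :+ ((con (+ 1000)) :* (vt :^ 3) :* (vx :^ 6) :* (vW :^ 4))
               :+ ((con -[1+ 479 ]) :* (vt :^ 3) :* (vx :^ 6) :* (vW :^ 5))
               :+ ((con (+ 1440)) :* (vt :^ 3) :* (vx :^ 8) :* (vW :^ 6))
               :+ ((con -[1+ 14 ]) :* (vt :^ 4) :* vx) :+ ((con (+ 216)) :* (vt :^ 4) :* (vx :^ 3))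
               :+ ((con (+ 32)) :* (vt :^ 4) :* (vx :^ 3) :* vW)
               :+ ((con -[1+ 79 ]) :* (vt :^ 4) :* (vx :^ 3) :* (vW :^ 2))
               :+ ((con (+ 1196)) :* (vt :^ 4) :* (vx :^ 5) :* (vW :^ 2))
               :+ ((con -[1+ 479 ]) :* (vt :^ 4) :* (vx :^ 5) :* (vW :^ 3))
               :+ ((con (+ 1760)) :* (vt :^ 4) :* (vx :^ 7) :* (vW :^ 4))
               :+ ((con (+ 420)) :* (vt :^ 5) :* (vx :^ 4))
               :+ ((con -[1+ 159 ]) :* (vt :^ 5) :* (vx :^ 4) :* vW)
               :+ ((con (+ 1040)) :* (vt :^ 5) :* (vx :^ 6) :* (vW :^ 2))
               :+ ((con (+ 240)) :* (vt :^ 6) :* (vx :^ 5)))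
        ; K  = (((con (+ 288)) :* (vx :^ 6) :* (vW :^ 5) :* vV)
               :+ ((con (+ 432)) :* (vx :^ 6) :* (vW :^ 5) :* vU) :+ ((con (+ 384)) :* (vx :^ 6) :* (vW :^ 6))
               :+ ((con -[1+ 107 ]) :* vt :* (vx :^ 3) :* (vW :^ 2))
               :+ ((con -[1+ 71 ]) :* vt :* (vx :^ 3) :* (vW :^ 2) :* vV)
               :+ ((con -[1+ 107 ]) :* vt :* (vx :^ 3) :* (vW :^ 2) :* vU)
               :+ ((con -[1+ 83 ]) :* vt :* (vx :^ 3) :* (vW :^ 3))
               :+ ((con (+ 384)) :* vt :* (vx :^ 5) :* (vW :^ 3) :* vV)
               :+ ((con (+ 576)) :* vt :* (vx :^ 5) :* (vW :^ 3) :* vU)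
               :+ ((con (+ 744)) :* vt :* (vx :^ 5) :* (vW :^ 4))
               :+ ((con (+ 384)) :* vt :* (vx :^ 7) :* (vW :^ 5) :* vV)
               :+ ((con (+ 576)) :* vt :* (vx :^ 7) :* (vW :^ 5) :* vU)
               :+ ((con (+ 320)) :* vt :* (vx :^ 7) :* (vW :^ 6)) :+ ((con (+ 24)) :* (vt :^ 2))
               :+ ((con -[1+ 35 ]) :* (vt :^ 2) :* (vx :^ 2))
               :+ ((con -[1+ 23 ]) :* (vt :^ 2) :* (vx :^ 2) :* vV)
               :+ ((con -[1+ 35 ]) :* (vt :^ 2) :* (vx :^ 2) :* vU)
               :+ ((con -[1+ 203 ]) :* (vt :^ 2) :* (vx :^ 2) :* vW)
               :+ ((con (+ 96)) :* (vt :^ 2) :* (vx :^ 4) :* vW :* vV)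
               :+ ((con (+ 144)) :* (vt :^ 2) :* (vx :^ 4) :* vW :* vU)
               :+ ((con (+ 144)) :* (vt :^ 2) :* (vx :^ 4) :* (vW :^ 2))
               :+ ((con -[1+ 95 ]) :* (vt :^ 2) :* (vx :^ 4) :* (vW :^ 2) :* vV)
               :+ ((con -[1+ 143 ]) :* (vt :^ 2) :* (vx :^ 4) :* (vW :^ 2) :* vU)
               :+ ((con -[1+ 15 ]) :* (vt :^ 2) :* (vx :^ 4) :* (vW :^ 3))
               :+ ((con (+ 512)) :* (vt :^ 2) :* (vx :^ 6) :* (vW :^ 3) :* vV)
               :+ ((con (+ 768)) :* (vt :^ 2) :* (vx :^ 6) :* (vW :^ 3) :* vU)
               :+ ((con (+ 608)) :* (vt :^ 2) :* (vx :^ 6) :* (vW :^ 4)) :+ ((con (+ 20)) :* (vt :^ 3) :* vx)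
               :+ ((con -[1+ 119 ]) :* (vt :^ 3) :* (vx :^ 3))
               :+ ((con -[1+ 31 ]) :* (vt :^ 3) :* (vx :^ 3) :* vV)
               :+ ((con -[1+ 47 ]) :* (vt :^ 3) :* (vx :^ 3) :* vU)
               :+ ((con -[1+ 175 ]) :* (vt :^ 3) :* (vx :^ 3) :* vW)
               :+ ((con (+ 128)) :* (vt :^ 3) :* (vx :^ 5) :* vW :* vV)
               :+ ((con (+ 192)) :* (vt :^ 3) :* (vx :^ 5) :* vW :* vU)
               :+ ((con (+ 192)) :* (vt :^ 3) :* (vx :^ 5) :* (vW :^ 2))
               :+ ((con -[1+ 95 ]) :* (vt :^ 4) :* (vx :^ 4)))
        ; L  = (((con (+ 48)) :* (vx :^ 6) :* (vW :^ 5) :* vV) :+ ((con (+ 92)) :* (vx :^ 6) :* (vW :^ 6))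
               :+ ((con -[1+ 71 ]) :* vt :* (vx :^ 3) :* (vW :^ 2))
               :+ ((con -[1+ 11 ]) :* vt :* (vx :^ 3) :* (vW :^ 2) :* vV)
               :+ ((con (+ 8)) :* vt :* (vx :^ 3) :* (vW :^ 3))
               :+ ((con (+ 64)) :* vt :* (vx :^ 5) :* (vW :^ 3) :* vV)
               :+ ((con (+ 116)) :* vt :* (vx :^ 5) :* (vW :^ 4))
               :+ ((con -[1+ 191 ]) :* vt :* (vx :^ 7) :* (vW :^ 5) :* vV)
               :+ ((con -[1+ 47 ]) :* vt :* (vx :^ 7) :* (vW :^ 6)) :+ ((con (+ 8)) :* (vt :^ 2))
               :+ ((con -[1+ 23 ]) :* (vt :^ 2) :* (vx :^ 2))
               :+ ((con -[1+ 3 ]) :* (vt :^ 2) :* (vx :^ 2) :* vV)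
               :+ ((con -[1+ 55 ]) :* (vt :^ 2) :* (vx :^ 2) :* vW)
               :+ ((con (+ 16)) :* (vt :^ 2) :* (vx :^ 4) :* vW :* vV)
               :+ ((con -[1+ 123 ]) :* (vt :^ 2) :* (vx :^ 4) :* (vW :^ 2))
               :+ ((con (+ 48)) :* (vt :^ 2) :* (vx :^ 4) :* (vW :^ 2) :* vV)
               :+ ((con (+ 64)) :* (vt :^ 2) :* (vx :^ 4) :* (vW :^ 3))
               :+ ((con -[1+ 255 ]) :* (vt :^ 2) :* (vx :^ 6) :* (vW :^ 3) :* vV)
               :+ ((con -[1+ 79 ]) :* (vt :^ 2) :* (vx :^ 6) :* (vW :^ 4))
               :+ ((con (+ 20)) :* (vt :^ 3) :* vx) :+ ((con -[1+ 83 ]) :* (vt :^ 3) :* (vx :^ 3))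
               :+ ((con (+ 16)) :* (vt :^ 3) :* (vx :^ 3) :* vV)
               :+ ((con -[1+ 63 ]) :* (vt :^ 3) :* (vx :^ 3) :* vW)
               :+ ((con -[1+ 63 ]) :* (vt :^ 3) :* (vx :^ 5) :* vW :* vV)
               :+ ((con -[1+ 79 ]) :* (vt :^ 3) :* (vx :^ 5) :* (vW :^ 2))
               :+ ((con -[1+ 47 ]) :* (vt :^ 4) :* (vx :^ 4)))
        ; M  = (((con -[1+ 131 ]) :* (vx :^ 6) :* (vW :^ 6))
               :+ ((con (+ 108)) :* vt :* (vx :^ 3) :* (vW :^ 2))
               :+ ((con (+ 12)) :* vt :* (vx :^ 3) :* (vW :^ 3))
               :+ ((con -[1+ 131 ]) :* vt :* (vx :^ 5) :* (vW :^ 4))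
               :+ ((con (+ 80)) :* vt :* (vx :^ 7) :* (vW :^ 6)) :+ ((con -[1+ 14 ]) :* (vt :^ 2))
               :+ ((con (+ 36)) :* (vt :^ 2) :* (vx :^ 2)) :+ ((con (+ 132)) :* (vt :^ 2) :* (vx :^ 2) :* vW)
               :+ ((con (+ 276)) :* (vt :^ 2) :* (vx :^ 4) :* (vW :^ 2))
               :+ ((con -[1+ 79 ]) :* (vt :^ 2) :* (vx :^ 4) :* (vW :^ 3))
               :+ ((con (+ 400)) :* (vt :^ 2) :* (vx :^ 6) :* (vW :^ 4))
               :+ ((con (+ 180)) :* (vt :^ 3) :* (vx :^ 3)) :+ ((con (+ 80)) :* (vt :^ 3) :* (vx :^ 3) :* vW)
               :+ ((con (+ 560)) :* (vt :^ 3) :* (vx :^ 5) :* (vW :^ 2))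
               :+ ((con (+ 240)) :* (vt :^ 4) :* (vx :^ 4)))
        }

      second-certificate : Certificate
      second-certificate = record
        { a  = (((con -[1+ 11 ]) :* vx) :+ ((con -[1+ 8 ]) :* vt))
        ; b  = (((con (+ 8)) :* vx) :+ ((con (+ 6)) :* vt))
        ; c  = (((con (+ 4)) :* vx) :+ ((con -[1+ 0 ]) :* vt))
        ; E′ = (((con -[1+ 47 ]) :* (vx :^ 4) :* (vW :^ 2) :* (vV :^ 2))
               :+ ((con -[1+ 95 ]) :* (vx :^ 4) :* (vW :^ 2) :* vU :* vV)
               :+ ((con (+ 144)) :* (vx :^ 4) :* (vW :^ 2) :* (vU :^ 2))
               :+ ((con -[1+ 79 ]) :* (vx :^ 4) :* (vW :^ 3) :* vV)
               :+ ((con -[1+ 47 ]) :* (vx :^ 4) :* (vW :^ 3) :* vU)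
               :+ ((con -[1+ 35 ]) :* (vx :^ 4) :* (vW :^ 4)) :+ ((con (+ 12)) :* vt :* vx)
               :+ ((con (+ 4)) :* vt :* vx :* vV) :+ ((con -[1+ 35 ]) :* vt :* vx :* vU)
               :+ ((con -[1+ 11 ]) :* vt :* vx :* vW) :+ ((con -[1+ 15 ]) :* vt :* (vx :^ 3) :* (vV :^ 2))
               :+ ((con -[1+ 31 ]) :* vt :* (vx :^ 3) :* vU :* vV)
               :+ ((con (+ 48)) :* vt :* (vx :^ 3) :* (vU :^ 2))
               :+ ((con -[1+ 79 ]) :* vt :* (vx :^ 3) :* vW :* vV)
               :+ ((con (+ 80)) :* vt :* (vx :^ 3) :* vW :* vU)
               :+ ((con -[1+ 39 ]) :* vt :* (vx :^ 3) :* (vW :^ 2))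
               :+ ((con (+ 12)) :* vt :* (vx :^ 3) :* (vW :^ 2) :* (vV :^ 2))
               :+ ((con -[1+ 71 ]) :* vt :* (vx :^ 3) :* (vW :^ 2) :* vU :* vV)
               :+ ((con (+ 108)) :* vt :* (vx :^ 3) :* (vW :^ 2) :* (vU :^ 2))
               :+ ((con (+ 16)) :* vt :* (vx :^ 3) :* (vW :^ 3) :* vV)
               :+ ((con -[1+ 47 ]) :* vt :* (vx :^ 3) :* (vW :^ 3) :* vU)
               :+ ((con (+ 9)) :* vt :* (vx :^ 3) :* (vW :^ 4)) :+ ((con (+ 9)) :* (vt :^ 2))
               :+ ((con (+ 8)) :* (vt :^ 2) :* vV) :+ ((con -[1+ 23 ]) :* (vt :^ 2) :* vU)
               :+ ((con -[1+ 8 ]) :* (vt :^ 2) :* vW) :+ ((con (+ 28)) :* (vt :^ 2) :* (vx :^ 2))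
               :+ ((con (+ 4)) :* (vt :^ 2) :* (vx :^ 2) :* (vV :^ 2))
               :+ ((con -[1+ 23 ]) :* (vt :^ 2) :* (vx :^ 2) :* vU :* vV)
               :+ ((con (+ 36)) :* (vt :^ 2) :* (vx :^ 2) :* (vU :^ 2))
               :+ ((con -[1+ 15 ]) :* (vt :^ 2) :* (vx :^ 2) :* vW :* vV)
               :+ ((con (+ 48)) :* (vt :^ 2) :* (vx :^ 2) :* vW :* vU)
               :+ ((con (+ 2)) :* (vt :^ 2) :* (vx :^ 2) :* (vW :^ 2)) :+ ((con (+ 25)) :* (vt :^ 3) :* vx))
        ; F  = (((con -[1+ 47 ]) :* (vx :^ 10) :* (vW :^ 10))
               :+ ((con (+ 96)) :* vt :* (vx :^ 7) :* (vW :^ 6))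
               :+ ((con -[1+ 95 ]) :* vt :* (vx :^ 7) :* (vW :^ 7))
               :+ ((con -[1+ 79 ]) :* vt :* (vx :^ 9) :* (vW :^ 8))
               :+ ((con (+ 60)) :* vt :* (vx :^ 9) :* (vW :^ 10))
               :+ ((con (+ 144)) :* (vt :^ 2) :* (vx :^ 4) :* (vW :^ 2))
               :+ ((con -[1+ 287 ]) :* (vt :^ 2) :* (vx :^ 4) :* (vW :^ 3))
               :+ ((con (+ 120)) :* (vt :^ 2) :* (vx :^ 4) :* (vW :^ 4))
               :+ ((con (+ 352)) :* (vt :^ 2) :* (vx :^ 6) :* (vW :^ 4))
               :+ ((con -[1+ 223 ]) :* (vt :^ 2) :* (vx :^ 6) :* (vW :^ 5))
               :+ ((con (+ 120)) :* (vt :^ 2) :* (vx :^ 6) :* (vW :^ 6))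
               :+ ((con -[1+ 239 ]) :* (vt :^ 2) :* (vx :^ 6) :* (vW :^ 7))
               :+ ((con (+ 160)) :* (vt :^ 2) :* (vx :^ 8) :* (vW :^ 6))
               :+ ((con (+ 340)) :* (vt :^ 2) :* (vx :^ 8) :* (vW :^ 8))
               :+ ((con -[1+ 23 ]) :* (vt :^ 3) :* vx) :+ ((con (+ 24)) :* (vt :^ 3) :* vx :* vW)
               :+ ((con (+ 48)) :* (vt :^ 3) :* (vx :^ 3)) :+ ((con (+ 32)) :* (vt :^ 3) :* (vx :^ 3) :* vW)
               :+ ((con -[1+ 67 ]) :* (vt :^ 3) :* (vx :^ 3) :* (vW :^ 2))
               :+ ((con -[1+ 239 ]) :* (vt :^ 3) :* (vx :^ 3) :* (vW :^ 3))
               :+ ((con (+ 165)) :* (vt :^ 3) :* (vx :^ 3) :* (vW :^ 4))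
               :+ ((con (+ 416)) :* (vt :^ 3) :* (vx :^ 5) :* (vW :^ 2))
               :+ ((con -[1+ 159 ]) :* (vt :^ 3) :* (vx :^ 5) :* (vW :^ 3))
               :+ ((con (+ 360)) :* (vt :^ 3) :* (vx :^ 5) :* (vW :^ 4))
               :+ ((con -[1+ 559 ]) :* (vt :^ 3) :* (vx :^ 5) :* (vW :^ 5))
               :+ ((con (+ 480)) :* (vt :^ 3) :* (vx :^ 7) :* (vW :^ 4))
               :+ ((con (+ 760)) :* (vt :^ 3) :* (vx :^ 7) :* (vW :^ 6)) :+ ((con -[1+ 14 ]) :* (vt :^ 4))
               :+ ((con (+ 15)) :* (vt :^ 4) :* vW) :+ ((con -[1+ 3 ]) :* (vt :^ 4) :* (vx :^ 2))
               :+ ((con -[1+ 49 ]) :* (vt :^ 4) :* (vx :^ 2) :* (vW :^ 2))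
               :+ ((con (+ 160)) :* (vt :^ 4) :* (vx :^ 4))
               :+ ((con -[1+ 31 ]) :* (vt :^ 4) :* (vx :^ 4) :* vW)
               :+ ((con (+ 360)) :* (vt :^ 4) :* (vx :^ 4) :* (vW :^ 2))
               :+ ((con -[1+ 399 ]) :* (vt :^ 4) :* (vx :^ 4) :* (vW :^ 3))
               :+ ((con (+ 400)) :* (vt :^ 4) :* (vx :^ 6) :* (vW :^ 2))
               :+ ((con (+ 840)) :* (vt :^ 4) :* (vx :^ 6) :* (vW :^ 4))
               :+ ((con -[1+ 14 ]) :* (vt :^ 5) :* vx) :+ ((con (+ 120)) :* (vt :^ 5) :* (vx :^ 3))
               :+ ((con -[1+ 79 ]) :* (vt :^ 5) :* (vx :^ 3) :* vW)
               :+ ((con (+ 112)) :* (vt :^ 5) :* (vx :^ 5))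
               :+ ((con (+ 460)) :* (vt :^ 5) :* (vx :^ 5) :* (vW :^ 2))
               :+ ((con (+ 100)) :* (vt :^ 6) :* (vx :^ 4)))
        ; K  = (((con -[1+ 383 ]) :* (vx :^ 7) :* (vW :^ 5) :* vV)
               :+ ((con (+ 576)) :* (vx :^ 7) :* (vW :^ 5) :* vU)
               :+ ((con -[1+ 191 ]) :* (vx :^ 7) :* (vW :^ 6))
               :+ ((con -[1+ 143 ]) :* vt :* (vx :^ 4) :* (vW :^ 2))
               :+ ((con (+ 96)) :* vt :* (vx :^ 4) :* (vW :^ 2) :* vV)
               :+ ((con -[1+ 143 ]) :* vt :* (vx :^ 4) :* (vW :^ 2) :* vU)
               :+ ((con (+ 48)) :* vt :* (vx :^ 4) :* (vW :^ 3))
               :+ ((con -[1+ 511 ]) :* vt :* (vx :^ 6) :* (vW :^ 3) :* vV)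
               :+ ((con (+ 768)) :* vt :* (vx :^ 6) :* (vW :^ 3) :* vU)
               :+ ((con -[1+ 159 ]) :* vt :* (vx :^ 6) :* (vW :^ 4))
               :+ ((con -[1+ 287 ]) :* vt :* (vx :^ 6) :* (vW :^ 5) :* vV)
               :+ ((con (+ 432)) :* vt :* (vx :^ 6) :* (vW :^ 5) :* vU)
               :+ ((con -[1+ 191 ]) :* vt :* (vx :^ 6) :* (vW :^ 6)) :+ ((con (+ 36)) :* (vt :^ 2) :* vx)
               :+ ((con -[1+ 47 ]) :* (vt :^ 2) :* (vx :^ 3))
               :+ ((con (+ 32)) :* (vt :^ 2) :* (vx :^ 3) :* vV)
               :+ ((con -[1+ 47 ]) :* (vt :^ 2) :* (vx :^ 3) :* vU)
               :+ ((con -[1+ 175 ]) :* (vt :^ 2) :* (vx :^ 3) :* vW)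
               :+ ((con -[1+ 107 ]) :* (vt :^ 2) :* (vx :^ 3) :* (vW :^ 2))
               :+ ((con (+ 72)) :* (vt :^ 2) :* (vx :^ 3) :* (vW :^ 2) :* vV)
               :+ ((con -[1+ 107 ]) :* (vt :^ 2) :* (vx :^ 3) :* (vW :^ 2) :* vU)
               :+ ((con (+ 60)) :* (vt :^ 2) :* (vx :^ 3) :* (vW :^ 3))
               :+ ((con -[1+ 127 ]) :* (vt :^ 2) :* (vx :^ 5) :* vW :* vV)
               :+ ((con (+ 192)) :* (vt :^ 2) :* (vx :^ 5) :* vW :* vU)
               :+ ((con -[1+ 63 ]) :* (vt :^ 2) :* (vx :^ 5) :* (vW :^ 2))
               :+ ((con -[1+ 383 ]) :* (vt :^ 2) :* (vx :^ 5) :* (vW :^ 3) :* vV)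
               :+ ((con (+ 576)) :* (vt :^ 2) :* (vx :^ 5) :* (vW :^ 3) :* vU)
               :+ ((con -[1+ 215 ]) :* (vt :^ 2) :* (vx :^ 5) :* (vW :^ 4)) :+ ((con (+ 24)) :* (vt :^ 3))
               :+ ((con -[1+ 35 ]) :* (vt :^ 3) :* (vx :^ 2))
               :+ ((con (+ 24)) :* (vt :^ 3) :* (vx :^ 2) :* vV)
               :+ ((con -[1+ 35 ]) :* (vt :^ 3) :* (vx :^ 2) :* vU)
               :+ ((con -[1+ 107 ]) :* (vt :^ 3) :* (vx :^ 2) :* vW)
               :+ ((con -[1+ 95 ]) :* (vt :^ 3) :* (vx :^ 4))
               :+ ((con -[1+ 95 ]) :* (vt :^ 3) :* (vx :^ 4) :* vW :* vV)
               :+ ((con (+ 144)) :* (vt :^ 3) :* (vx :^ 4) :* vW :* vU)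
               :+ ((con -[1+ 95 ]) :* (vt :^ 3) :* (vx :^ 4) :* (vW :^ 2))
               :+ ((con -[1+ 71 ]) :* (vt :^ 4) :* (vx :^ 3)))
        ; L  = (((con -[1+ 191 ]) :* (vx :^ 7) :* (vW :^ 5) :* vV)
               :+ ((con -[1+ 175 ]) :* (vx :^ 7) :* (vW :^ 6))
               :+ ((con (+ 96)) :* vt :* (vx :^ 4) :* (vW :^ 2))
               :+ ((con (+ 48)) :* vt :* (vx :^ 4) :* (vW :^ 2) :* vV)
               :+ ((con -[1+ 255 ]) :* vt :* (vx :^ 6) :* (vW :^ 3) :* vV)
               :+ ((con -[1+ 207 ]) :* vt :* (vx :^ 6) :* (vW :^ 4))
               :+ ((con (+ 48)) :* vt :* (vx :^ 6) :* (vW :^ 5) :* vV)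
               :+ ((con (+ 28)) :* vt :* (vx :^ 6) :* (vW :^ 6)) :+ ((con -[1+ 3 ]) :* (vt :^ 2) :* vx)
               :+ ((con (+ 32)) :* (vt :^ 2) :* (vx :^ 3)) :+ ((con (+ 16)) :* (vt :^ 2) :* (vx :^ 3) :* vV)
               :+ ((con (+ 64)) :* (vt :^ 2) :* (vx :^ 3) :* vW)
               :+ ((con (+ 72)) :* (vt :^ 2) :* (vx :^ 3) :* (vW :^ 2))
               :+ ((con -[1+ 11 ]) :* (vt :^ 2) :* (vx :^ 3) :* (vW :^ 2) :* vV)
               :+ ((con -[1+ 55 ]) :* (vt :^ 2) :* (vx :^ 3) :* (vW :^ 3))
               :+ ((con -[1+ 63 ]) :* (vt :^ 2) :* (vx :^ 5) :* vW :* vV)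
               :+ ((con (+ 48)) :* (vt :^ 2) :* (vx :^ 5) :* (vW :^ 2))
               :+ ((con (+ 64)) :* (vt :^ 2) :* (vx :^ 5) :* (vW :^ 3) :* vV)
               :+ ((con (+ 84)) :* (vt :^ 2) :* (vx :^ 5) :* (vW :^ 4)) :+ ((con -[1+ 7 ]) :* (vt :^ 3))
               :+ ((con (+ 24)) :* (vt :^ 3) :* (vx :^ 2)) :+ ((con -[1+ 3 ]) :* (vt :^ 3) :* (vx :^ 2) :* vV)
               :+ ((con (+ 24)) :* (vt :^ 3) :* (vx :^ 2) :* vW) :+ ((con (+ 80)) :* (vt :^ 3) :* (vx :^ 4))
               :+ ((con (+ 16)) :* (vt :^ 3) :* (vx :^ 4) :* vW :* vV)
               :+ ((con (+ 100)) :* (vt :^ 3) :* (vx :^ 4) :* (vW :^ 2))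
               :+ ((con (+ 44)) :* (vt :^ 4) :* (vx :^ 3)))
        ; M  = (((con -[1+ 47 ]) :* (vx :^ 7) :* (vW :^ 6)) :+ ((con (+ 144)) :* vt :* (vx :^ 4) :* (vW :^ 2))
               :+ ((con -[1+ 143 ]) :* vt :* (vx :^ 4) :* (vW :^ 3))
               :+ ((con (+ 16)) :* vt :* (vx :^ 6) :* (vW :^ 4))
               :+ ((con (+ 60)) :* vt :* (vx :^ 6) :* (vW :^ 6)) :+ ((con -[1+ 23 ]) :* (vt :^ 2) :* vx)
               :+ ((con (+ 48)) :* (vt :^ 2) :* (vx :^ 3)) :+ ((con (+ 80)) :* (vt :^ 2) :* (vx :^ 3) :* vW)
               :+ ((con (+ 60)) :* (vt :^ 2) :* (vx :^ 3) :* (vW :^ 2))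
               :+ ((con -[1+ 179 ]) :* (vt :^ 2) :* (vx :^ 3) :* (vW :^ 3))
               :+ ((con (+ 176)) :* (vt :^ 2) :* (vx :^ 5) :* (vW :^ 2))
               :+ ((con (+ 220)) :* (vt :^ 2) :* (vx :^ 5) :* (vW :^ 4)) :+ ((con -[1+ 14 ]) :* (vt :^ 3))
               :+ ((con (+ 20)) :* (vt :^ 3) :* (vx :^ 2)) :+ ((con (+ 20)) :* (vt :^ 3) :* (vx :^ 2) :* vW)
               :+ ((con (+ 112)) :* (vt :^ 3) :* (vx :^ 4))
               :+ ((con (+ 260)) :* (vt :^ 3) :* (vx :^ 4) :* (vW :^ 2))
               :+ ((con (+ 100)) :* (vt :^ 4) :* (vx :^ 3)))
        }

      pde₁ : ∀ W → P W ≈ 0# → DL W ≈ DR W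
      pde₁ W PW≈0 = begin
        DL W       ≈⟨ *-congˡ (*-congˡ (*-congˡ (ℒₚ-sound (+ 1) (+ 1) (+ 1) (+ 2) -[1+ 2 ] (+ 1)))) ⟩
        ⟦ DLₚ ⟧ ρ₂ ≈⟨ x∙y⁻¹≈ε⇒x≈y _ _ (certified (DLₚ :+ :- DRₚ) first-certificate refl refl refl) ⟩
        ⟦ DRₚ ⟧ ρ₂ ≈⟨ ℒₚ-sound (+ 0) (+ 3) (+ 1) -[1+ 1 ] (+ 3) (+ 1) ⟨
        DR W       ∎
        where open AtRoot W PW≈0

      pde₂ : ∀ W → P W ≈ 0# → D̃L W ≈ D̃R W
      pde₂ W PW≈0 = begin
        D̃L W       ≈⟨ *-congˡ (*-congˡ (ℒₚ-sound (+ 1) -[1+ 0 ] (+ 1) (+ 0) (+ 3) (+ 1))) ⟩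
        ⟦ D̃Lₚ ⟧ ρ₂ ≈⟨ x∙y⁻¹≈ε⇒x≈y _ _ (certified (D̃Lₚ :+ :- D̃Rₚ) second-certificate refl refl refl) ⟩
        ⟦ D̃Rₚ ⟧ ρ₂ ≈⟨ *-congˡ (ℒₚ-sound (+ 2) -[1+ 2 ] (+ 1) (+ 0) -[1+ 2 ] (+ 1)) ⟨
        D̃R W       ∎
        where open AtRoot W PW≈0

module LaurentPolynomials where
  open import Data.Nat as ℕ using (ℕ; zero; suc)
  import Data.Nat.Properties as ℕP
  open import Data.Integer as ℤ using (ℤ; +_; -[1+_])
  import Data.Integer.Properties as ℤP
  open import Data.Rational as ℚ using (ℚ; 0ℚ; 1ℚ)
  import Data.Rational.Properties as ℚP
  open import Data.Rational.Unnormalised as ℚᵘ using (mkℚᵘ; *≡*)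
  import Data.Rational.Unnormalised.Properties as ℚᵘP
  open import Data.List using (List; []; _∷_; replicate; _++_)
  open import Data.Product using (_,_)
  open import Relation.Binary.PropositionalEquality as ≡
    using (_≡_; refl; cong; cong₂; sym; trans; module ≡-Reasoning)
  open import Defs

  open ≡-Reasoning
  module Q = CoefficientLists ℚP.+-*-commutativeRing
  open Q using (_≐_; coeffwise; coeff-≐; _+ₚ_; _*ₚ_; coeff)

  ℤtoℚ-+ : ∀ i j → ℤtoℚ (i ℤ.+ j) ≡ ℤtoℚ i ℚ.+ ℤtoℚ j
  ℤtoℚ-+ i j = ℚP.toℚᵘ-injective (ℚᵘP.≃-trans (ℚP.toℚᵘ-fromℚᵘ (mkℚᵘ (i ℤ.+ j) 0))
    (ℚᵘP.≃-trans over-1 (ℚᵘP.≃-sym (ℚᵘP.≃-trans (ℚP.toℚᵘ-homo-+ (ℤtoℚ i) (ℤtoℚ j))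
      (ℚᵘP.+-cong (ℚP.toℚᵘ-fromℚᵘ (mkℚᵘ i 0)) (ℚP.toℚᵘ-fromℚᵘ (mkℚᵘ j 0)))))))
    where
    over-1 : mkℚᵘ (i ℤ.+ j) 0 ℚᵘ.≃ (mkℚᵘ i 0 ℚᵘ.+ mkℚᵘ j 0)
    over-1 = *≡* (cong (ℤ._* + 1) (cong₂ ℤ._+_ (sym (ℤP.*-identityʳ i)) (sym (ℤP.*-identityʳ j))))

  nth≡coeff : ∀ i p → nth i p ≡ coeff i p
  nth≡coeff i       []      = refl
  nth≡coeff zero    (a ∷ p) = refl
  nth≡coeff (suc i) (a ∷ p) = nth≡coeff i p

  addP≡+ₚ : ∀ p q → addP p q ≡ p +ₚ q
  addP≡+ₚ []      q       = refl
  addP≡+ₚ (a ∷ p) []      = refl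
  addP≡+ₚ (a ∷ p) (b ∷ q) = cong (_ ∷_) (addP≡+ₚ p q)

  mulP≡*ₚ : ∀ p q → mulP p q ≡ p *ₚ q
  mulP≡*ₚ []      q = refl
  mulP≡*ₚ (a ∷ p) q = trans (cong (λ r → addP (scaleP a q) (0ℚ ∷ r)) (mulP≡*ₚ p q)) (addP≡+ₚ (scaleP a q) (0ℚ ∷ p *ₚ q))

  ≡⇒≐ : ∀ {p q} → p ≡ q → p ≐ q
  ≡⇒≐ refl = Q.≐-refl

  pad : ℕ → List ℚ → List ℚ
  pad j p = replicate j 0ℚ ++ p

  coeffAt : ℤ → List ℚ → ℚ
  coeffAt (+ j)    p = nth j p
  coeffAt -[1+ _ ] p = 0ℚ

  coeffL-mkL : ∀ k p m → coeffL (mkL k p) m ≡ coeffAt (m ℤ.+ + k) p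
  coeffL-mkL k p m with m ℤ.+ + k
  ... | + j      = refl
  ... | -[1+ _ ] = refl

  coeffAt-0∷ : ∀ z q → coeffAt (z ℤ.+ + 1) (0ℚ ∷ q) ≡ coeffAt z q
  coeffAt-0∷ (+ n)           q = trans (cong (λ w → coeffAt w (0ℚ ∷ q)) (ℤP.pos-+ n 1))
                                        (cong (λ k → nth k (0ℚ ∷ q)) (ℕP.+-comm n 1))
  coeffAt-0∷ -[1+ zero ]    q = refl
  coeffAt-0∷ -[1+ suc n ]   q = refl

  coeffAt-pad : ∀ j z p → coeffAt (z ℤ.+ + j) (pad j p) ≡ coeffAt z p
  coeffAt-pad zero    z p = cong (λ w → coeffAt w p) (ℤP.+-identityʳ z)
  coeffAt-pad (suc j) z p = begin
    coeffAt (z ℤ.+ + suc j) (0ℚ ∷ pad j p)            ≡⟨ cong (λ w → coeffAt w (0ℚ ∷ pad j p)) index-step ⟩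
    coeffAt ((z ℤ.+ + j) ℤ.+ + 1) (0ℚ ∷ pad j p)      ≡⟨ coeffAt-0∷ (z ℤ.+ + j) (pad j p) ⟩
    coeffAt (z ℤ.+ + j) (pad j p)                     ≡⟨ coeffAt-pad j z p ⟩
    coeffAt z p                                       ∎
    where
    index-step : z ℤ.+ + suc j ≡ (z ℤ.+ + j) ℤ.+ + 1
    index-step = trans (cong (λ w → z ℤ.+ w) (trans (cong +_ (ℕP.+-comm 1 j)) (ℤP.pos-+ j 1))) (sym (ℤP.+-assoc z (+ j) (+ 1)))

  coeffAt-≐ : ∀ z {p q} → p ≐ q → coeffAt z p ≡ coeffAt z q
  coeffAt-≐ (+ j)    {p} {q} e = trans (nth≡coeff j p) (trans (coeff-≐ e j) (sym (nth≡coeff j q)))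
  coeffAt-≐ -[1+ _ ] e = refl

  coeffAt-+ : ∀ z p q → coeffAt z (addP p q) ≡ coeffAt z p ℚ.+ coeffAt z q
  coeffAt-+ (+ j) p q = begin
    nth j (addP p q)             ≡⟨ nth≡coeff j (addP p q) ⟩
    coeff j (addP p q)           ≡⟨ cong (coeff j) (addP≡+ₚ p q) ⟩
    coeff j (p +ₚ q)             ≡⟨ Q.coeff-+ j p q ⟩
    coeff j p ℚ.+ coeff j q      ≡⟨ cong₂ ℚ._+_ (nth≡coeff j p) (nth≡coeff j q) ⟨
    nth j p ℚ.+ nth j q          ∎
  coeffAt-+ -[1+ _ ] p q = refl

  coeffAt-scale : ∀ z c p → coeffAt z (scaleP c p) ≡ c ℚ.* coeffAt z p
  coeffAt-scale (+ j) c p = trans (nth≡coeff j (scaleP c p)) (trans (Q.coeff-· j c p) (cong (c ℚ.*_) (sym (nth≡coeff j p))))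
  coeffAt-scale -[1+ _ ] c p = sym (ℚP.*-zeroʳ c)

  coeff-weightP : ∀ j e p → coeff j (weightP e p) ≡ ℤtoℚ (e ℤ.+ + j) ℚ.* coeff j p
  coeff-weightP j       e []      = sym (ℚP.*-zeroʳ (ℤtoℚ (e ℤ.+ + j)))
  coeff-weightP zero    e (a ∷ p) = cong (λ w → ℤtoℚ w ℚ.* a) (sym (ℤP.+-identityʳ e))
  coeff-weightP (suc j) e (a ∷ p) = trans (coeff-weightP j (e ℤ.+ + 1) p) (cong (λ w → ℤtoℚ w ℚ.* coeff j p) reassoc)
    where
    reassoc : (e ℤ.+ + 1) ℤ.+ + j ≡ e ℤ.+ + suc j
    reassoc = trans (ℤP.+-assoc e (+ 1) (+ j)) (cong (λ w → e ℤ.+ w) (sym (ℤP.pos-+ 1 j)))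

  coeffAt-weight : ∀ z e p → coeffAt z (weightP e p) ≡ ℤtoℚ (e ℤ.+ z) ℚ.* coeffAt z p
  coeffAt-weight (+ j)    e p = trans (nth≡coeff j (weightP e p))
    (trans (coeff-weightP j e p) (cong (ℤtoℚ (e ℤ.+ + j) ℚ.*_) (sym (nth≡coeff j p))))
  coeffAt-weight -[1+ n ] e p = sym (ℚP.*-zeroʳ (ℤtoℚ (e ℤ.+ -[1+ n ])))

  ≈L-refl : ∀ {a} → a ≈L a
  ≈L-refl m = refl

  ≈L-sym : ∀ {a b} → a ≈L b → b ≈L a
  ≈L-sym e m = sym (e m)

  ≈L-trans : ∀ {a b c} → a ≈L b → b ≈L c → a ≈L c
  ≈L-trans e f m = trans (e m) (f m)

  ≡⇒≈L : ∀ {a b} → a ≡ b → a ≈L b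
  ≡⇒≈L refl = ≈L-refl

  mkL-cong : ∀ {k k′ p p′} → k ≡ k′ → p ≐ p′ → mkL k p ≈L mkL k′ p′
  mkL-cong {k} {p = p} {p′} refl e m = trans (coeffL-mkL k p m) (trans (coeffAt-≐ (m ℤ.+ + k) e) (sym (coeffL-mkL k p′ m)))

  mkL-injective : ∀ {k p q} → mkL k p ≈L mkL k q → p ≐ q
  mkL-injective {k} {p} {q} e = coeffwise λ i → begin
    coeff i p                     ≡⟨ nth≡coeff i p ⟨
    coeffAt (+ i) p               ≡⟨ cong (λ w → coeffAt w p) (cancel i) ⟨
    coeffAt (m i ℤ.+ + k) p       ≡⟨ coeffL-mkL k p (m i) ⟨
    coeffL (mkL k p) (m i)        ≡⟨ e (m i) ⟩
    coeffL (mkL k q) (m i)        ≡⟨ coeffL-mkL k q (m i) ⟩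
    coeffAt (m i ℤ.+ + k) q       ≡⟨ cong (λ w → coeffAt w q) (cancel i) ⟩
    coeffAt (+ i) q               ≡⟨ nth≡coeff i q ⟩
    coeff i q                     ∎
    where
    m : ℕ → ℤ
    m i = + i ℤ.- + k
    cancel : ∀ i → m i ℤ.+ + k ≡ + i
    cancel i = trans (ℤP.+-assoc (+ i) (ℤ.- (+ k)) (+ k))
                     (trans (cong (λ w → + i ℤ.+ w) (ℤP.+-inverseˡ (+ k))) (ℤP.+-identityʳ (+ i)))

  mkL-pad : ∀ {k′} j k p → k′ ≡ j ℕ.+ k → mkL k′ (pad j p) ≈L mkL k p
  mkL-pad j k p refl m = begin
    coeffL (mkL (j ℕ.+ k) (pad j p)) m     ≡⟨ coeffL-mkL (j ℕ.+ k) (pad j p) m ⟩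
    coeffAt (m ℤ.+ + (j ℕ.+ k)) (pad j p)  ≡⟨ cong (λ w → coeffAt w (pad j p)) reassoc ⟩
    coeffAt ((m ℤ.+ + k) ℤ.+ + j) (pad j p) ≡⟨ coeffAt-pad j (m ℤ.+ + k) p ⟩
    coeffAt (m ℤ.+ + k) p                  ≡⟨ coeffL-mkL k p m ⟨
    coeffL (mkL k p) m                     ∎
    where
    reassoc : m ℤ.+ + (j ℕ.+ k) ≡ (m ℤ.+ + k) ℤ.+ + j
    reassoc = trans (cong (λ w → m ℤ.+ w) (trans (ℤP.pos-+ j k) (ℤP.+-comm (+ j) (+ k)))) (sym (ℤP.+-assoc m (+ k) (+ j)))

  coeffL-0 : ∀ m → coeffL 0L m ≡ 0ℚ
  coeffL-0 m = trans (coeffL-mkL 0 [] m) (empty (m ℤ.+ + 0))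
    where
    empty : ∀ z → coeffAt z [] ≡ 0ℚ
    empty (+ j)    = refl
    empty -[1+ _ ] = refl

  coeffL-+ : ∀ a b m → coeffL (a +L b) m ≡ coeffL a m ℚ.+ coeffL b m
  coeffL-+ (mkL k p) (mkL l q) m = begin
    coeffL (mkL (k ℕ.+ l) (addP (pad l p) (pad k q))) m
      ≡⟨ coeffL-mkL (k ℕ.+ l) _ m ⟩
    coeffAt (m ℤ.+ + (k ℕ.+ l)) (addP (pad l p) (pad k q))
      ≡⟨ coeffAt-+ (m ℤ.+ + (k ℕ.+ l)) (pad l p) (pad k q) ⟩
    coeffAt (m ℤ.+ + (k ℕ.+ l)) (pad l p) ℚ.+ coeffAt (m ℤ.+ + (k ℕ.+ l)) (pad k q)
      ≡⟨ cong₂ ℚ._+_ (coeffL-mkL (k ℕ.+ l) (pad l p) m) (coeffL-mkL (k ℕ.+ l) (pad k q) m) ⟨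
    coeffL (mkL (k ℕ.+ l) (pad l p)) m ℚ.+ coeffL (mkL (k ℕ.+ l) (pad k q)) m
      ≡⟨ cong₂ ℚ._+_ (mkL-pad l k p (ℕP.+-comm k l) m) (mkL-pad k l q refl m) ⟩
    coeffL (mkL k p) m ℚ.+ coeffL (mkL l q) m ∎

  coeffL-scale : ∀ c a m → coeffL (scaleL c a) m ≡ c ℚ.* coeffL a m
  coeffL-scale c (mkL k p) m =
    trans (coeffL-mkL k _ m) (trans (coeffAt-scale (m ℤ.+ + k) c p) (cong (c ℚ.*_) (sym (coeffL-mkL k p m))))

  coeffL-t : ∀ a m → coeffL (tL a) m ≡ coeffL a (m ℤ.- + 1)
  coeffL-t (mkL k p) m = begin
    coeffL (mkL k (0ℚ ∷ p)) m                       ≡⟨ coeffL-mkL k _ m ⟩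
    coeffAt (m ℤ.+ + k) (0ℚ ∷ p)                    ≡⟨ cong (λ w → coeffAt w (0ℚ ∷ p)) index-step ⟩
    coeffAt ((m′ ℤ.+ + k) ℤ.+ + 1) (0ℚ ∷ p)         ≡⟨ coeffAt-0∷ (m′ ℤ.+ + k) p ⟩
    coeffAt (m′ ℤ.+ + k) p                          ≡⟨ coeffL-mkL k p m′ ⟨
    coeffL (mkL k p) m′                             ∎
    where
    m′ = m ℤ.- + 1
    index-step : m ℤ.+ + k ≡ (m′ ℤ.+ + k) ℤ.+ + 1
    index-step = begin
      m ℤ.+ + k                       ≡⟨ cong (ℤ._+ + k) (trans (ℤP.+-assoc m (ℤ.- + 1) (+ 1)) (ℤP.+-identityʳ m)) ⟨
      (m′ ℤ.+ + 1) ℤ.+ + k            ≡⟨ ℤP.+-assoc m′ (+ 1) (+ k) ⟩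
      m′ ℤ.+ (+ 1 ℤ.+ + k)            ≡⟨ cong (λ w → m′ ℤ.+ w) (ℤP.+-comm (+ 1) (+ k)) ⟩
      m′ ℤ.+ (+ k ℤ.+ + 1)            ≡⟨ ℤP.+-assoc m′ (+ k) (+ 1) ⟨
      (m′ ℤ.+ + k) ℤ.+ + 1            ∎

  coeffL-θ : ∀ a m → coeffL (θtL a) m ≡ ℤtoℚ m ℚ.* coeffL a m
  coeffL-θ (mkL k p) m = begin
    coeffL (mkL k (weightP (ℤ.- (+ k)) p)) m                    ≡⟨ coeffL-mkL k _ m ⟩
    coeffAt (m ℤ.+ + k) (weightP (ℤ.- (+ k)) p)                 ≡⟨ coeffAt-weight (m ℤ.+ + k) _ p ⟩
    ℤtoℚ (ℤ.- (+ k) ℤ.+ (m ℤ.+ + k)) ℚ.* coeffAt (m ℤ.+ + k) p  ≡⟨ cong₂ ℚ._*_ (cong ℤtoℚ cancel) (sym (coeffL-mkL k p m)) ⟩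
    ℤtoℚ m ℚ.* coeffL (mkL k p) m                               ∎
    where
    cancel : ℤ.- (+ k) ℤ.+ (m ℤ.+ + k) ≡ m
    cancel = trans (cong (λ w → ℤ.- (+ k) ℤ.+ w) (ℤP.+-comm m (+ k)))
             (trans (sym (ℤP.+-assoc (ℤ.- (+ k)) (+ k) m)) (trans (cong (ℤ._+ m) (ℤP.+-inverseˡ (+ k))) (ℤP.+-identityˡ m)))

  negL : Laurent → Laurent
  negL = scaleL (ℚ.- 1ℚ)

  1L : Laurent
  1L = constL 1ℚ

  coeffL-neg : ∀ a m → coeffL (negL a) m ≡ ℚ.- coeffL a m
  coeffL-neg a m = trans (coeffL-scale (ℚ.- 1ℚ) a m)
    (trans (sym (ℚP.neg-distribˡ-* 1ℚ (coeffL a m))) (cong ℚ.-_ (ℚP.*-identityˡ (coeffL a m))))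

  *ₚ-pad : ∀ n p q → p *ₚ pad n q ≐ pad n (p *ₚ q)
  *ₚ-pad zero    p q = Q.≐-refl
  *ₚ-pad (suc n) p q = Q.≐-trans (Q.*ₚ-comm p (0ℚ ∷ pad n q)) (Q.≐-trans (Q.0∷-*ₚ (pad n q) p)
    (Q.∷-cong refl (Q.≐-trans (Q.*ₚ-comm (pad n q) p) (*ₚ-pad n p q))))

  pad-*ₚ : ∀ n p q → pad n p *ₚ q ≐ pad n (p *ₚ q)
  pad-*ₚ n p q = Q.≐-trans (Q.*ₚ-comm (pad n p) q) (Q.≐-trans (*ₚ-pad n q p) (pad-cong n (Q.*ₚ-comm q p)))
    where
    pad-cong : ∀ n {u v} → u ≐ v → pad n u ≐ pad n v
    pad-cong zero    e = e
    pad-cong (suc n) e = Q.∷-cong refl (pad-cong n e)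

  *L-mkL : ∀ k p l q → (mkL k p *L mkL l q) ≈L mkL (k ℕ.+ l) (p *ₚ q)
  *L-mkL k p l q = mkL-cong refl (≡⇒≐ (mulP≡*ₚ p q))

  +L-cong : ∀ {a a′ b b′} → a ≈L a′ → b ≈L b′ → (a +L b) ≈L (a′ +L b′)
  +L-cong {a} {a′} {b} {b′} e f m = trans (coeffL-+ a b m) (trans (cong₂ ℚ._+_ (e m) (f m)) (sym (coeffL-+ a′ b′ m)))

  +L-assoc : ∀ a b c → (a +L b) +L c ≈L a +L (b +L c)
  +L-assoc a b c m = begin
    coeffL ((a +L b) +L c) m                          ≡⟨ coeffL-+ (a +L b) c m ⟩
    coeffL (a +L b) m ℚ.+ coeffL c m                  ≡⟨ cong (ℚ._+ coeffL c m) (coeffL-+ a b m) ⟩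
    (coeffL a m ℚ.+ coeffL b m) ℚ.+ coeffL c m        ≡⟨ ℚP.+-assoc (coeffL a m) (coeffL b m) (coeffL c m) ⟩
    coeffL a m ℚ.+ (coeffL b m ℚ.+ coeffL c m)        ≡⟨ cong (coeffL a m ℚ.+_) (coeffL-+ b c m) ⟨
    coeffL a m ℚ.+ coeffL (b +L c) m                  ≡⟨ coeffL-+ a (b +L c) m ⟨
    coeffL (a +L (b +L c)) m                          ∎

  +L-comm : ∀ a b → (a +L b) ≈L (b +L a)
  +L-comm a b m = trans (coeffL-+ a b m) (trans (ℚP.+-comm (coeffL a m) (coeffL b m)) (sym (coeffL-+ b a m)))

  +L-identityˡ : ∀ a → (0L +L a) ≈L a
  +L-identityˡ a m = trans (coeffL-+ 0L a m) (trans (cong (ℚ._+ coeffL a m) (coeffL-0 m)) (ℚP.+-identityˡ (coeffL a m)))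

  +L-inverseˡ : ∀ a → (negL a +L a) ≈L 0L
  +L-inverseˡ a m = trans (coeffL-+ (negL a) a m)
    (trans (cong (ℚ._+ coeffL a m) (coeffL-neg a m)) (trans (ℚP.+-inverseˡ (coeffL a m)) (sym (coeffL-0 m))))

  negL-cong : ∀ {a b} → a ≈L b → negL a ≈L negL b
  negL-cong {a} {b} e m = trans (coeffL-neg a m) (trans (cong ℚ.-_ (e m)) (sym (coeffL-neg b m)))

  *L-assoc : ∀ a b c → (a *L b) *L c ≈L a *L (b *L c)
  *L-assoc (mkL k p) (mkL l q) (mkL n r) =
    mkL-cong (ℕP.+-assoc k l n) (Q.≐-trans left (Q.≐-trans (Q.*ₚ-assoc p q r) (Q.≐-sym right)))
    where
    left : mulP (mulP p q) r ≐ (p *ₚ q) *ₚ r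
    left = ≡⇒≐ (trans (cong (λ w → mulP w r) (mulP≡*ₚ p q)) (mulP≡*ₚ (p *ₚ q) r))
    right : mulP p (mulP q r) ≐ p *ₚ (q *ₚ r)
    right = ≡⇒≐ (trans (cong (mulP p) (mulP≡*ₚ q r)) (mulP≡*ₚ p (q *ₚ r)))

  *L-comm : ∀ a b → (a *L b) ≈L (b *L a)
  *L-comm (mkL k p) (mkL l q) =
    mkL-cong (ℕP.+-comm k l) (Q.≐-trans (≡⇒≐ (mulP≡*ₚ p q)) (Q.≐-trans (Q.*ₚ-comm p q) (≡⇒≐ (sym (mulP≡*ₚ q p)))))

  *L-identityˡ : ∀ a → (1L *L a) ≈L a
  *L-identityˡ (mkL k p) = mkL-cong refl (Q.≐-trans (≡⇒≐ (mulP≡*ₚ (1ℚ ∷ []) p)) (Q.*ₚ-identityˡ p))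

  *L-distribˡ : ∀ a b c → a *L (b +L c) ≈L (a *L b) +L (a *L c)
  *L-distribˡ (mkL k p) (mkL l q) (mkL n r) = ≈L-trans (*L-mkL k p (l ℕ.+ n) _) (≈L-trans
    (mkL-cong refl (Q.≐-trans (Q.*ₚ-cong (Q.≐-refl {p}) (≡⇒≐ (addP≡+ₚ (pad n q) (pad l r))))
      (Q.≐-trans (Q.*ₚ-distribˡ p (pad n q) (pad l r)) (Q.+ₚ-cong (*ₚ-pad n p q) (*ₚ-pad l p r)))))
    λ m → begin
      coeffL (mkL K (pad n (p *ₚ q) +ₚ pad l (p *ₚ r))) m
        ≡⟨ cong (λ w → coeffL (mkL K w) m) (sym (addP≡+ₚ (pad n (p *ₚ q)) (pad l (p *ₚ r)))) ⟩
      coeffL (mkL K (addP (pad n (p *ₚ q)) (pad l (p *ₚ r)))) m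
        ≡⟨ trans (coeffL-mkL K _ m) (trans (coeffAt-+ (m ℤ.+ + K) _ _) (sym (cong₂ ℚ._+_ (coeffL-mkL K _ m) (coeffL-mkL K _ m)))) ⟩
      coeffL (mkL K (pad n (p *ₚ q))) m ℚ.+ coeffL (mkL K (pad l (p *ₚ r))) m
        ≡⟨ cong₂ ℚ._+_ (mkL-pad n (k ℕ.+ l) _ align₁ m) (mkL-pad l (k ℕ.+ n) _ align₂ m) ⟩
      coeffL (mkL (k ℕ.+ l) (p *ₚ q)) m ℚ.+ coeffL (mkL (k ℕ.+ n) (p *ₚ r)) m
        ≡⟨ cong₂ ℚ._+_ (*L-mkL k p l q m) (*L-mkL k p n r m) ⟨
      coeffL (mkL k p *L mkL l q) m ℚ.+ coeffL (mkL k p *L mkL n r) m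
        ≡⟨ coeffL-+ (mkL k p *L mkL l q) (mkL k p *L mkL n r) m ⟨
      coeffL ((mkL k p *L mkL l q) +L (mkL k p *L mkL n r)) m ∎)
    where
    K = k ℕ.+ (l ℕ.+ n)
    align₁ : K ≡ n ℕ.+ (k ℕ.+ l)
    align₁ = trans (sym (ℕP.+-assoc k l n)) (ℕP.+-comm (k ℕ.+ l) n)
    align₂ : K ≡ l ℕ.+ (k ℕ.+ n)
    align₂ = trans (sym (ℕP.+-assoc k l n)) (trans (cong (ℕ._+ n) (ℕP.+-comm k l)) (ℕP.+-assoc l k n))

  -- congruence: align both shifts to k + k′ and compare the padded lists
  *L-congˡ : ∀ {a a′} b → a ≈L a′ → (a *L b) ≈L (a′ *L b)
  *L-congˡ {mkL k p} {mkL k′ p′} (mkL l q) e = ≈L-trans (aligned k′ p k) (≈L-trans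
    (mkL-cong (cong (ℕ._+ l) (ℕP.+-comm k′ k)) (Q.*ₚ-cong same-padded Q.≐-refl)) (≈L-sym (aligned k p′ k′)))
    where
    same-padded : pad k′ p ≐ pad k p′
    same-padded = mkL-injective {k′ ℕ.+ k}
      (≈L-trans (mkL-pad k′ k p refl) (≈L-trans e (≈L-sym (mkL-pad k k′ p′ (ℕP.+-comm k′ k)))))
    aligned : ∀ j r i → (mkL i r *L mkL l q) ≈L mkL ((j ℕ.+ i) ℕ.+ l) (pad j r *ₚ q)
    aligned j r i = ≈L-trans (*L-mkL i r l q) (≈L-trans (≈L-sym (mkL-pad j (i ℕ.+ l) (r *ₚ q) refl))
      (mkL-cong (sym (ℕP.+-assoc j i l)) (Q.≐-sym (pad-*ₚ j r q))))

  *L-cong : ∀ {a a′ b b′} → a ≈L a′ → b ≈L b′ → (a *L b) ≈L (a′ *L b′)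
  *L-cong {a} {a′} {b} {b′} e f =
    ≈L-trans (*L-congˡ b e) (≈L-trans (*L-comm a′ b) (≈L-trans (*L-congˡ a′ f) (*L-comm b′ a′)))

  LaurentRing : CommutativeRing _ _
  LaurentRing = record
    { Carrier = Laurent ; _≈_ = _≈L_ ; _+_ = _+L_ ; _*_ = _*L_ ; -_ = negL ; 0# = 0L ; 1# = 1L
    ; isCommutativeRing = record
      { isRing = record
        { +-isAbelianGroup = record
          { isGroup = record
            { isMonoid = record
              { isSemigroup = record
                { isMagma = record
                  { isEquivalence = record { refl = λ {a} → ≈L-refl {a} ; sym = λ {a} {b} → ≈L-sym {a} {b}
                                           ; trans = λ {a} {b} {c} → ≈L-trans {a} {b} {c} }
                  ; ∙-cong = +L-cong }
                ; assoc = +L-assoc }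
              ; identity = +L-identityˡ , (λ a → ≈L-trans (+L-comm a 0L) (+L-identityˡ a)) }
            ; inverse = +L-inverseˡ , (λ a → ≈L-trans (+L-comm a (negL a)) (+L-inverseˡ a))
            ; ⁻¹-cong = negL-cong }
          ; comm = +L-comm }
        ; *-cong = *L-cong
        ; *-assoc = *L-assoc
        ; *-identity = *L-identityˡ , (λ a → ≈L-trans (*L-comm a 1L) (*L-identityˡ a))
        ; distrib = *L-distribˡ , (λ a b c → ≈L-trans (*L-comm (b +L c) a)
                      (≈L-trans (*L-distribˡ a b c) (+L-cong (*L-comm a b) (*L-comm a c)))) }
      ; *-comm = *L-comm } }

  θ-cong : ∀ {a b} → a ≈L b → θtL a ≈L θtL b
  θ-cong {a} {b} e m = trans (coeffL-θ a m) (trans (cong (ℤtoℚ m ℚ.*_) (e m)) (sym (coeffL-θ b m)))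

  θ-+ : ∀ a b → θtL (a +L b) ≈L (θtL a +L θtL b)
  θ-+ a b m = begin
    coeffL (θtL (a +L b)) m                          ≡⟨ coeffL-θ (a +L b) m ⟩
    ℤtoℚ m ℚ.* coeffL (a +L b) m                     ≡⟨ cong (ℤtoℚ m ℚ.*_) (coeffL-+ a b m) ⟩
    ℤtoℚ m ℚ.* (coeffL a m ℚ.+ coeffL b m)           ≡⟨ ℚP.*-distribˡ-+ (ℤtoℚ m) (coeffL a m) (coeffL b m) ⟩
    ℤtoℚ m ℚ.* coeffL a m ℚ.+ ℤtoℚ m ℚ.* coeffL b m  ≡⟨ cong₂ ℚ._+_ (coeffL-θ a m) (coeffL-θ b m) ⟨
    coeffL (θtL a) m ℚ.+ coeffL (θtL b) m            ≡⟨ coeffL-+ (θtL a) (θtL b) m ⟨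
    coeffL (θtL a +L θtL b) m                        ∎

  -- Leibniz rule for integer weights: the weight of a term of the Cauchy
  -- product splits as (e + j) + (f + (i − j))
  weightP-* : ∀ e f p q → weightP (e ℤ.+ f) (p *ₚ q) ≐ weightP e p *ₚ q +ₚ p *ₚ weightP f q
  weightP-* e f p q = coeffwise λ i → begin
    coeff i (weightP (e ℤ.+ f) (p *ₚ q))                                   ≡⟨ coeff-weightP i (e ℤ.+ f) (p *ₚ q) ⟩
    w i ℚ.* coeff i (p *ₚ q)                                               ≡⟨ cong (w i ℚ.*_) (Q.coeff-* i p q) ⟩
    w i ℚ.* Q.sum≤ i (λ j → coeff j p ℚ.* coeff (i ℕ.∸ j) q)               ≡⟨ Q.sum≤-*ˡ i (w i) _ ⟨
    Q.sum≤ i (λ j → w i ℚ.* (coeff j p ℚ.* coeff (i ℕ.∸ j) q))             ≡⟨ Q.sum≤-cong i (split i) ⟩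
    Q.sum≤ i (λ j → coeff j (weightP e p) ℚ.* coeff (i ℕ.∸ j) q ℚ.+ coeff j p ℚ.* coeff (i ℕ.∸ j) (weightP f q))
                                                                           ≡⟨ Q.sum≤-+ i _ _ ⟩
    Q.sum≤ i (λ j → coeff j (weightP e p) ℚ.* coeff (i ℕ.∸ j) q) ℚ.+ Q.sum≤ i (λ j → coeff j p ℚ.* coeff (i ℕ.∸ j) (weightP f q))
                                                                           ≡⟨ cong₂ ℚ._+_ (Q.coeff-* i (weightP e p) q) (Q.coeff-* i p (weightP f q)) ⟨
    coeff i (weightP e p *ₚ q) ℚ.+ coeff i (p *ₚ weightP f q)              ≡⟨ Q.coeff-+ i (weightP e p *ₚ q) (p *ₚ weightP f q) ⟨
    coeff i (weightP e p *ₚ q +ₚ p *ₚ weightP f q)                         ∎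
    where
    open import Algebra.Properties.CommutativeSemigroup ℤP.+-commutativeSemigroup using (interchange)
    open import Algebra.Properties.CommutativeSemigroup (CommutativeRing.*-commutativeSemigroup ℚP.+-*-commutativeRing) using (x∙yz≈y∙xz)
    w : ℕ → ℚ
    w i = ℤtoℚ ((e ℤ.+ f) ℤ.+ + i)
    split : ∀ i j → j ℕ.≤ i → w i ℚ.* (coeff j p ℚ.* coeff (i ℕ.∸ j) q)
          ≡ coeff j (weightP e p) ℚ.* coeff (i ℕ.∸ j) q ℚ.+ coeff j p ℚ.* coeff (i ℕ.∸ j) (weightP f q)
    split i j j≤i = begin
      w i ℚ.* (a ℚ.* b)                                          ≡⟨ cong (λ v → ℤtoℚ v ℚ.* (a ℚ.* b)) weights ⟩
      ℤtoℚ (u ℤ.+ v) ℚ.* (a ℚ.* b)                               ≡⟨ cong (ℚ._* (a ℚ.* b)) (ℤtoℚ-+ u v) ⟩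
      (ℤtoℚ u ℚ.+ ℤtoℚ v) ℚ.* (a ℚ.* b)                          ≡⟨ ℚP.*-distribʳ-+ (a ℚ.* b) (ℤtoℚ u) (ℤtoℚ v) ⟩
      ℤtoℚ u ℚ.* (a ℚ.* b) ℚ.+ ℤtoℚ v ℚ.* (a ℚ.* b)
        ≡⟨ cong₂ ℚ._+_ (sym (ℚP.*-assoc (ℤtoℚ u) a b)) (x∙yz≈y∙xz (ℤtoℚ v) a b) ⟩
      (ℤtoℚ u ℚ.* a) ℚ.* b ℚ.+ a ℚ.* (ℤtoℚ v ℚ.* b)
        ≡⟨ cong₂ ℚ._+_ (cong (ℚ._* b) (coeff-weightP j e p)) (cong (a ℚ.*_) (coeff-weightP (i ℕ.∸ j) f q)) ⟨
      coeff j (weightP e p) ℚ.* b ℚ.+ a ℚ.* coeff (i ℕ.∸ j) (weightP f q) ∎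
      where
      a = coeff j p
      b = coeff (i ℕ.∸ j) q
      u = e ℤ.+ + j
      v = f ℤ.+ + (i ℕ.∸ j)
      weights : (e ℤ.+ f) ℤ.+ + i ≡ u ℤ.+ v
      weights = trans (cong (λ n → (e ℤ.+ f) ℤ.+ + n) (sym (ℕP.m+[n∸m]≡n j≤i)))
                (trans (cong (λ n → (e ℤ.+ f) ℤ.+ n) (ℤP.pos-+ j (i ℕ.∸ j))) (interchange e f (+ j) (+ (i ℕ.∸ j))))

  θ-leibniz : ∀ a b → θtL (a *L b) ≈L ((θtL a *L b) +L (a *L θtL b))
  θ-leibniz (mkL k p) (mkL l q) m = begin
    coeffL (mkL (k ℕ.+ l) (weightP (ℤ.- (+ (k ℕ.+ l))) (mulP p q))) m
      ≡⟨ mkL-cong refl (≡⇒≐ (cong₂ weightP (trans (cong ℤ.-_ (ℤP.pos-+ k l)) (ℤP.neg-distrib-+ (+ k) (+ l))) (mulP≡*ₚ p q))) m ⟩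
    coeffL (mkL (k ℕ.+ l) (weightP (ℤ.- (+ k) ℤ.+ ℤ.- (+ l)) (p *ₚ q))) m
      ≡⟨ mkL-cong refl (Q.≐-trans (weightP-* (ℤ.- (+ k)) (ℤ.- (+ l)) p q) (≡⇒≐ (sym (addP≡+ₚ (wp *ₚ q) (p *ₚ wq))))) m ⟩
    coeffL (mkL (k ℕ.+ l) (addP (wp *ₚ q) (p *ₚ wq))) m
      ≡⟨ trans (coeffL-mkL (k ℕ.+ l) _ m) (trans (coeffAt-+ (m ℤ.+ + (k ℕ.+ l)) _ _)
           (sym (cong₂ ℚ._+_ (coeffL-mkL (k ℕ.+ l) _ m) (coeffL-mkL (k ℕ.+ l) _ m)))) ⟩
    coeffL (mkL (k ℕ.+ l) (wp *ₚ q)) m ℚ.+ coeffL (mkL (k ℕ.+ l) (p *ₚ wq)) m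
      ≡⟨ cong₂ ℚ._+_ (*L-mkL k wp l q m) (*L-mkL k p l wq m) ⟨
    coeffL (θtL (mkL k p) *L mkL l q) m ℚ.+ coeffL (mkL k p *L θtL (mkL l q)) m
      ≡⟨ coeffL-+ (θtL (mkL k p) *L mkL l q) (mkL k p *L θtL (mkL l q)) m ⟨
    coeffL ((θtL (mkL k p) *L mkL l q) +L (mkL k p *L θtL (mkL l q))) m ∎
    where
    wp = weightP (ℤ.- (+ k)) p
    wq = weightP (ℤ.- (+ l)) q

  θt-derivation : Derivations.IsDerivation LaurentRing θtL
  θt-derivation = record { δ-cong = θ-cong ; δ-+ = θ-+ ; δ-leibniz = θ-leibniz }

  tL1 : Laurent
  tL1 = tL 1L

  t⁻¹L : Laurent
  t⁻¹L = mkL 1 (1ℚ ∷ [])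

  t*L : ∀ a → (tL1 *L a) ≈L tL a
  t*L (mkL k p) = mkL-cong refl (Q.≐-trans (≡⇒≐ (mulP≡*ₚ (0ℚ ∷ 1ℚ ∷ []) p)) (Q.X-*ₚ p))

  t-inverse : (tL1 *L t⁻¹L) ≈L 1L
  t-inverse = ≈L-trans (t*L t⁻¹L) (mkL-pad 1 0 (1ℚ ∷ []) refl)

  const*L : ∀ c a → (constL c *L a) ≈L scaleL c a
  const*L c (mkL k p) = mkL-cong refl (Q.≐-trans (≡⇒≐ (mulP≡*ₚ (c ∷ []) p)) (Q.single-*ₚ c p))

  tL-cong : ∀ {a b} → a ≈L b → tL a ≈L tL b
  tL-cong {a} {b} e m = trans (coeffL-t a m) (trans (e (m ℤ.- + 1)) (sym (coeffL-t b m)))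

  θ-tL : ∀ a → θtL (tL a) ≈L (tL a +L tL (θtL a))
  θ-tL a m = begin
    coeffL (θtL (tL a)) m                            ≡⟨ coeffL-θ (tL a) m ⟩
    ℤtoℚ m ℚ.* coeffL (tL a) m                       ≡⟨ cong (ℤtoℚ m ℚ.*_) (coeffL-t a m) ⟩
    ℤtoℚ m ℚ.* coeffL a m′                           ≡⟨ cong (λ w → ℤtoℚ w ℚ.* coeffL a m′) m≡1+m′ ⟩
    ℤtoℚ (+ 1 ℤ.+ m′) ℚ.* coeffL a m′                ≡⟨ cong (ℚ._* coeffL a m′) (ℤtoℚ-+ (+ 1) m′) ⟩
    (1ℚ ℚ.+ ℤtoℚ m′) ℚ.* coeffL a m′                 ≡⟨ ℚP.*-distribʳ-+ (coeffL a m′) 1ℚ (ℤtoℚ m′) ⟩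
    1ℚ ℚ.* coeffL a m′ ℚ.+ ℤtoℚ m′ ℚ.* coeffL a m′   ≡⟨ cong₂ ℚ._+_ (ℚP.*-identityˡ (coeffL a m′)) (sym (coeffL-θ a m′)) ⟩
    coeffL a m′ ℚ.+ coeffL (θtL a) m′                ≡⟨ cong₂ ℚ._+_ (coeffL-t a m) (coeffL-t (θtL a) m) ⟨
    coeffL (tL a) m ℚ.+ coeffL (tL (θtL a)) m        ≡⟨ coeffL-+ (tL a) (tL (θtL a)) m ⟨
    coeffL (tL a +L tL (θtL a)) m                    ∎
    where
    m′ = m ℤ.- + 1
    m≡1+m′ : m ≡ + 1 ℤ.+ m′
    m≡1+m′ = sym (trans (ℤP.+-comm (+ 1) m′) (trans (ℤP.+-assoc m (ℤ.- + 1) (+ 1)) (ℤP.+-identityʳ m)))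

  θ-const : ∀ c → θtL (constL c) ≈L 0L
  θ-const c m = trans (coeffL-θ (constL c) m) (trans (cong (ℤtoℚ m ℚ.*_) (coeffL-mkL 0 (c ∷ []) m)) (trans (degree-0 m) (sym (coeffL-0 m))))
    where
    degree-0 : ∀ m → ℤtoℚ m ℚ.* coeffAt (m ℤ.+ + 0) (c ∷ []) ≡ 0ℚ
    degree-0 (+ zero)    = ℚP.*-zeroˡ c
    degree-0 (+ (suc n)) = ℚP.*-zeroʳ (ℤtoℚ (+ suc n))
    degree-0 -[1+ n ]    = ℚP.*-zeroʳ (ℤtoℚ -[1+ n ])

  θ-t : θtL tL1 ≈L tL1
  θ-t = ≈L-trans (θ-tL 1L) (≈L-trans (+L-cong (≈L-refl {tL1}) (tL-cong (θ-const 1ℚ))) t0-vanishes)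
    where
    t0-vanishes : (tL1 +L tL 0L) ≈L tL1
    t0-vanishes m = trans (coeffL-+ tL1 (tL 0L) m)
      (trans (cong (coeffL tL1 m ℚ.+_) (trans (coeffL-t 0L m) (coeffL-0 (m ℤ.- + 1)))) (ℚP.+-identityʳ (coeffL tL1 m)))

  coeffL-const : ∀ c m → coeffL (constL c) m ≡ coeffAt (m ℤ.+ + 0) (c ∷ [])
  coeffL-const c = coeffL-mkL 0 (c ∷ [])

  constL-+ : ∀ a b → (constL a +L constL b) ≈L constL (a ℚ.+ b)
  constL-+ a b m = trans (coeffL-+ (constL a) (constL b) m)
    (trans (cong₂ ℚ._+_ (coeffL-const a m) (coeffL-const b m)) (trans (pointwise (m ℤ.+ + 0)) (sym (coeffL-const (a ℚ.+ b) m))))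
    where
    pointwise : ∀ z → coeffAt z (a ∷ []) ℚ.+ coeffAt z (b ∷ []) ≡ coeffAt z (a ℚ.+ b ∷ [])
    pointwise (+ zero)    = refl
    pointwise (+ (suc n)) = ℚP.+-identityˡ 0ℚ
    pointwise -[1+ n ]    = ℚP.+-identityˡ 0ℚ

  fromℤ-constL : ∀ z → IntegerRingSolver.fromℤ LaurentRing z ≈L constL (ℤtoℚ z)
  fromℤ-constL (+ n)    = naturals n
    where
    naturals : ∀ n → IntegerRingSolver.fromℕ LaurentRing n ≈L constL (ℕtoℚ n)
    naturals zero m  = trans (coeffL-0 m) (sym (trans (coeffL-const 0ℚ m) (zero-constant (m ℤ.+ + 0))))
      where
      zero-constant : ∀ z → coeffAt z (0ℚ ∷ []) ≡ 0ℚ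
      zero-constant (+ zero)    = refl
      zero-constant (+ (suc n)) = refl
      zero-constant -[1+ n ]    = refl
    naturals (suc n) = ≈L-trans (+L-cong (≈L-refl {1L}) (naturals n))
                                (≈L-trans (constL-+ 1ℚ (ℕtoℚ n)) (≡⇒≈L (cong constL (sym (ℤtoℚ-+ (+ 1) (+ n))))))
  fromℤ-constL -[1+ n ] = ≈L-trans (negL-cong (fromℤ-constL (+ suc n)))
    (≡⇒≈L (cong constL (trans (sym (ℚP.neg-distribˡ-* 1ℚ (ℕtoℚ (suc n)))) (cong ℚ.-_ (ℚP.*-identityˡ _)))))

-- Power series in x over ℚ[t, t⁻¹] are compared with polynomials below a
-- degree N, i.e. with elements of A[x]/(xᴺ), A = ℚ[t, t⁻¹].  Each operation
-- of the definitions (sums, Cauchy products, t·, x·, scalars, θt, θx)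
-- matches the corresponding ring operation there, so the equation and the
-- operators D_L, D_R, D̃_L, D̃_R become those of AlgebraicEquation in the
-- ring A[x]/(xᴺ), where t is a unit and x is nilpotent.
module PowerSeries where
  open import Data.Nat as ℕ using (ℕ; zero; suc; _∸_; _<_; s≤s; z≤n)
  import Data.Nat.Properties as ℕP
  open import Data.Integer as ℤ using (+_; -[1+_])
  open import Data.Rational using (1ℚ)
  open import Data.List using ([]; _∷_; map; applyUpTo)
  open import Data.Product using (_,_)
  open import Function using (_∘_)
  open import Relation.Binary.PropositionalEquality as ≡ using (_≡_)
  open import Defs

  open LaurentPolynomials
  open CoefficientLists LaurentRing
  module L = CommutativeRing LaurentRing
  module 𝕋 (N : ℕ) = CommutativeRing (Truncated N)

  infix 4 _≃[_]_
  record _≃[_]_ (f : R) (N : ℕ) (a : Poly) : Set where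
    constructor series≃
    field coeff-≃ : ∀ i → i < N → f i ≈L coeff i a
  open _≃[_]_

  ≃-≈[] : ∀ {N f a b} → f ≃[ N ] a → a ≈[ N ] b → f ≃[ N ] b
  ≃-≈[] e a≈b = series≃ λ i i<N → ≈L-trans (coeff-≃ e i i<N) (coeff-≈ a≈b i i<N)

  ≃-agree : ∀ {N f g a b} → f ≃[ N ] a → g ≃[ N ] b → a ≈[ N ] b → ∀ i → i < N → f i ≈L g i
  ≃-agree f≃a g≃b a≈b i i<N = ≈L-trans (coeff-≃ (≃-≈[] f≃a a≈b) i i<N) (≈L-sym (coeff-≃ g≃b i i<N))

  truncate : ℕ → R → Poly
  truncate N f = applyUpTo f N

  truncate-≃ : ∀ N f → f ≃[ N ] truncate N f
  truncate-≃ N f = series≃ (go N f)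
    where
    go : ∀ N f i → i < N → f i ≈L coeff i (truncate N f)
    go (suc N) f zero    _         = ≈L-refl
    go (suc N) f (suc i) (s≤s i<N) = go N (f ∘ suc) i i<N

  T T⁻¹ : Poly
  T   = tL1 ∷ []
  T⁻¹ = t⁻¹L ∷ []

  module _ {N : ℕ} where
    +R-≃ : ∀ {f g a b} → f ≃[ N ] a → g ≃[ N ] b → f +R g ≃[ N ] a +ₚ b
    +R-≃ {a = a} {b} e e′ = series≃ λ i i<N → ≈L-trans (+L-cong (coeff-≃ e i i<N) (coeff-≃ e′ i i<N)) (≈L-sym (coeff-+ i a b))

    *R-≃ : ∀ {f g a b} → f ≃[ N ] a → g ≃[ N ] b → f *R g ≃[ N ] a *ₚ b
    *R-≃ {f} {g} {a} {b} e e′ = series≃ λ i i<N → ≈L-trans (≡⇒≈L (sumTo≡sum≤ i _)) (≈L-trans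
      (sum≤-cong i λ j j≤i → *L-cong (coeff-≃ e j (ℕP.≤-<-trans j≤i i<N))
                                     (coeff-≃ e′ (i ∸ j) (ℕP.≤-<-trans (ℕP.m∸n≤m i j) i<N)))
      (≈L-sym (coeff-* i a b)))
      where
      sumTo≡sum≤ : ∀ n h → sumTo n h ≡ sum≤ n h
      sumTo≡sum≤ zero    h = ≡.refl
      sumTo≡sum≤ (suc n) h = ≡.cong (_+L h (suc n)) (sumTo≡sum≤ n h)

    scale-≃ : ∀ {f a} c → f ≃[ N ] a → c ·R f ≃[ N ] (constL c ∷ []) *ₚ a
    scale-≃ {f} {a} c e = series≃ λ i i<N → ≈L-trans (≈L-sym (const*L c (f i)))
      (≈L-trans (*L-cong (≈L-refl {constL c}) (coeff-≃ e i i<N)) (≈L-sym (coeff-single-* i (constL c) a)))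

    q-≃ : ∀ {f a} z → f ≃[ N ] a → q z ·R f ≃[ N ] IntegerRingSolver.fromℤ (Truncated N) z *ₚ a
    q-≃ {f} {a} z e = ≃-≈[] {N} {q z ·R f} {(c ∷ []) *ₚ a} (scale-≃ (ℤtoℚ z) e)
      (*ₚ-cong-below {N} {c ∷ []} {fromℤᴺ z} {a} {a} (≈[]-sym (≈[]-trans (fromℤ-constant N z) (single-cong (fromℤ-constL z)))) ≈[]-refl)
      where
      c = constL (ℤtoℚ z)
      fromℤᴺ = IntegerRingSolver.fromℤ (Truncated N)

    t-≃ : ∀ {f a} → f ≃[ N ] a → tR f ≃[ N ] T *ₚ a
    t-≃ {f} {a} e = series≃ λ i i<N → ≈L-trans (≈L-sym (t*L (f i)))
      (≈L-trans (*L-cong (≈L-refl {tL1}) (coeff-≃ e i i<N)) (≈L-sym (coeff-single-* i tL1 a)))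

    x-≃ : ∀ {f a} → f ≃[ N ] a → xR f ≃[ N ] X *ₚ a
    x-≃ {f} {a} e = series≃ go
      where
      go : ∀ i → i < N → xR f i ≈L coeff i (X *ₚ a)
      go zero    _   = ≈L-sym (coeff-≐ (X-*ₚ a) 0)
      go (suc i) i<N = ≈L-trans (coeff-≃ e i (ℕP.<-trans (ℕP.n<1+n i) i<N)) (≈L-sym (coeff-≐ (X-*ₚ a) (suc i)))

    θt-≃ : ∀ {f a} → f ≃[ N ] a → θt f ≃[ N ] map θtL a
    θt-≃ {a = a} e = series≃ λ i i<N →
      ≈L-trans (θ-cong (coeff-≃ e i i<N)) (≈L-sym (coeff-map θtL (Derivations.Derivation.δ-0 LaurentRing θt-derivation) i a))

    θx-≃ : ∀ {f a} → f ≃[ N ] a → θx f ≃[ N ] weight 0 a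
    θx-≃ {f} {a} e = series≃ λ i i<N → ≈L-trans (≈L-sym (const*L (ℕtoℚ i) (f i)))
      (≈L-trans (*L-cong (≈L-sym (fromℤ-constL (+ i))) (coeff-≃ e i i<N)) (≈L-sym (coeff-weight i 0 a)))

    const-≃ : ∀ c → cR c ≃[ N ] (constL c ∷ [])
    const-≃ c = series≃ λ { zero _ → ≈L-refl ; (suc i) _ → ≈L-refl }

  ≃-unique : ∀ {N f a b} → f ≃[ N ] a → f ≃[ N ] b → a ≈[ N ] b
  ≃-unique f≃a f≃b = below λ i i<N → ≈L-trans (≈L-sym (coeff-≃ f≃a i i<N)) (coeff-≃ f≃b i i<N)

  ≈-by-approximation : ∀ {f g} (a b : ℕ → Poly) → (∀ N → f ≃[ N ] a N) → (∀ N → g ≃[ N ] b N) →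
                       (∀ N → a N ≈[ N ] b N) → f ≈ g
  ≈-by-approximation a b f≃a g≃b a≈b n = ≃-agree (f≃a (suc n)) (g≃b (suc n)) (a≈b (suc n)) n (ℕP.n<1+n n)

  module _ (N : ℕ) where
    open Derivations.Derivation LaurentRing θt-derivation using (δ-0; δ-1)

    T-inverse : T *ₚ T⁻¹ ≈[ N ] (1L ∷ [])
    T-inverse = ≈[]-trans (≐⇒≈[ N (single-*ₚ tL1 T⁻¹)) (single-cong t-inverse)

    θt-T : map θtL T ≈[ N ] T
    θt-T = single-cong θ-t

    θx-T : weight 0 T ≈[ N ] []
    θx-T = below λ { zero _ → L.zeroˡ tL1 ; (suc i) _ → ≈L-refl }

    θt-X : map θtL X ≈[ N ] []
    θt-X = below λ { zero _ → δ-0 ; (suc zero) _ → δ-1 ; (suc (suc i)) _ → ≈L-refl }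

    θx-X : weight 0 X ≈[ N ] X
    θx-X = below λ { zero _ → L.zeroˡ 0L ; (suc zero) _ → ≈L-trans (L.*-identityʳ _) (L.+-identityʳ 1L)
                   ; (suc (suc i)) _ → ≈L-refl }

  module AtPrecision (N : ℕ) where
    open AlgebraicEquation (Truncated N) using (module Equation)
    open Equation T X T⁻¹ (T-inverse N) N (X-nilpotent N) public
    open Differential (map-derivation N θt-derivation) (euler-derivation N) (map-euler-comm N θt-derivation)
                      (θt-T N) (θx-T N) (θt-X N) (θx-X N) public

  module _ {N : ℕ} where
    open AtPrecision N
    open IntegerRingSolver (Truncated N) using (fromℤ)

    ℒ-≃ : ∀ {f a} x y z → f ≃[ N ] a → lin (q x) (q y) (q z) f ≃[ N ] ℒ x y z a
    ℒ-≃ x y z e = +R-≃ (+R-≃ (q-≃ x e) (q-≃ y (θt-≃ e))) (q-≃ z (θx-≃ e))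

    one-≃ : oneR ≃[ N ] fromℤ (+ 1)
    one-≃ = ≃-≈[] (const-≃ 1ℚ) (≈[]-sym (≈[]-trans (fromℤ-constant N (+ 1)) (single-cong (fromℤ-constL (+ 1)))))

    equation-≃ : ∀ {V a} → V ≃[ N ] a → algLHS V ≃[ N ] P a
    equation-≃ e = +R-≃ (+R-≃ (+R-≃ (t-≃ (+R-≃ one-≃ (t-≃ (x-≃ one-≃)))) (q-≃ (ℤ.- + 1) (t-≃ e)))
                               (q-≃ (+ 2) (t-≃ (x-≃ (x-≃ (*R-≃ e e))))))
                        (x-≃ (x-≃ (x-≃ (*R-≃ (*R-≃ (*R-≃ e e) e) e))))

    DL-≃ : ∀ {V a} → V ≃[ N ] a → D-L V ≃[ N ] DL a
    DL-≃ e = q-≃ (+ 4) (t-≃ (x-≃ (ℒ-≃ (+ 1) (+ 1) (+ 1) (ℒ-≃ (+ 2) -[1+ 2 ] (+ 1) e))))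

    DR-≃ : ∀ {V a} → V ≃[ N ] a → D-R V ≃[ N ] DR a
    DR-≃ e = ℒ-≃ (+ 0) (+ 3) (+ 1) (ℒ-≃ -[1+ 1 ] (+ 3) (+ 1) e)

    D̃L-≃ : ∀ {V a} → V ≃[ N ] a → D̃-L V ≃[ N ] D̃L a
    D̃L-≃ e = q-≃ (+ 4) (x-≃ (ℒ-≃ (+ 1) -[1+ 0 ] (+ 1) (ℒ-≃ (+ 0) (+ 3) (+ 1) e)))

    D̃R-≃ : ∀ {V a} → V ≃[ N ] a → D̃-R V ≃[ N ] D̃R a
    D̃R-≃ e = t-≃ (ℒ-≃ (+ 2) -[1+ 2 ] (+ 1) (ℒ-≃ (+ 0) -[1+ 2 ] (+ 1) e))

    solution⇒root : ∀ {V a} → IsSolution V → V ≃[ N ] a → P a ≈[ N ] []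
    solution⇒root sol e = ≃-unique (equation-≃ e) (series≃ λ i _ → sol i)

  -- The solution, by x-adic iteration of the fixed-point map Φ of P:
  -- Φ(a) = 1 + t x + x Ψ(a), so each iteration fixes one more coefficient.
  Ψ Φ : Poly → Poly
  Ψ a = ((1L +L 1L) ∷ []) *ₚ (X *ₚ (a *ₚ a)) +ₚ T⁻¹ *ₚ (X *ₚ (X *ₚ (((a *ₚ a) *ₚ a) *ₚ a)))
  Φ a = ((1L ∷ []) +ₚ T *ₚ X) +ₚ X *ₚ Ψ a

  -- Φ is the fixed-point map of AlgebraicEquation, at every precision
  -- (the ring operations of A[x]/(xᴺ) do not depend on N)
  Φ-at-precision : ∀ N a → Φ a ≡ AtPrecision.Φ N a
  Φ-at-precision N a = ≡.refl

  Φ-contracts : ∀ {k a b} → a ≈[ k ] b → Φ a ≈[ suc k ] Φ b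
  Φ-contracts {k} {a} {b} a≈b = +ₚ-cong-below {suc k} {(1L ∷ []) +ₚ T *ₚ X} ≈[]-refl (X-*ₚ-lift Ψa≈Ψb)
    where
    open 𝕋 k using (+-cong; *-cong; *-congˡ)
    Ψa≈Ψb : Ψ a ≈[ k ] Ψ b
    Ψa≈Ψb = +-cong (*-congˡ {(1L +L 1L) ∷ []} (*-congˡ {X} (*-cong a≈b a≈b)))
                   (*-congˡ {T⁻¹} (*-congˡ {X} (*-congˡ {X} (*-cong (*-cong (*-cong a≈b a≈b) a≈b) a≈b))))

  approx : ℕ → Poly
  approx zero    = []
  approx (suc n) = Φ (approx n)

  approx-step : ∀ k → approx (suc k) ≈[ k ] approx k
  approx-step zero    = below λ i ()
  approx-step (suc k) = Φ-contracts (approx-step k)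

  approx-stable : ∀ m k → approx (m ℕ.+ k) ≈[ k ] approx k
  approx-stable zero    k = ≈[]-refl
  approx-stable (suc m) k = ≈[]-trans (≈[]-mono (ℕP.m≤n+m k m) (approx-step (m ℕ.+ k))) (approx-stable m k)

  -- the solution: its n-th coefficient is fixed from the (n+1)-st iterate on
  W : R
  W n = coeff n (approx (suc n))

  W-≃ : ∀ N → W ≃[ N ] approx N
  W-≃ N = series≃ λ i i<N → coeff-≈ (≈[]-sym (≡.subst (λ M → approx M ≈[ suc i ] approx (suc i))
                                                       (ℕP.m∸n+n≡m i<N) (approx-stable (N ∸ suc i) (suc i)))) i (ℕP.n<1+n i)

  -- approx N is a root of P in A[x]/(xᴺ): P(a) = t(Φ(a) − a)
  approx-root : ∀ N → AtPrecision.P N (approx N) ≈[ N ] []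
  approx-root N = begin
    P (approx N)                                ≈⟨ P-fixed-point (approx N) ⟩
    T * (AtPrecision.Φ N (approx N) - approx N) ≡⟨ ≡.cong (λ b → T * (b - approx N)) (Φ-at-precision N (approx N)) ⟨
    T * (Φ (approx N) - approx N)               ≈⟨ *-congˡ {T} (+-congʳ (approx-step N)) ⟩
    T * (approx N - approx N)                   ≈⟨ *-congˡ {T} (-‿inverseʳ (approx N)) ⟩
    T * 0#                                      ≈⟨ zeroʳ T ⟩
    0#                                          ∎
    where
    open AtPrecision N using (P; P-fixed-point)
    open 𝕋 N using (_*_; _-_; 0#; *-congˡ; +-congʳ; -‿inverseʳ; zeroʳ; setoid)
    open import Relation.Binary.Reasoning.Setoid setoid

  Φ-mod-x² : ∀ a → Φ a ≈[ 2 ] (1L ∷ tL1 ∷ [])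
  Φ-mod-x² a = below go
    where
    c = (1L ∷ []) +ₚ T *ₚ X
    v = X *ₚ (((a *ₚ a) *ₚ a) *ₚ a)
    Ψ-0 : coeff 0 (Ψ a) ≈L 0L
    Ψ-0 = ≈L-trans (coeff-+ 0 (((1L +L 1L) ∷ []) *ₚ (X *ₚ (a *ₚ a))) (T⁻¹ *ₚ (X *ₚ v)))
                   (≈L-trans (+L-cong (X-multiple (1L +L 1L) (a *ₚ a)) (X-multiple t⁻¹L v)) (L.+-identityʳ 0L))
    go : ∀ i → i < 2 → coeff i (Φ a) ≈L coeff i (1L ∷ tL1 ∷ [])
    go zero _ = ≈L-trans (coeff-+ 0 c (X *ₚ Ψ a)) (≈L-trans (+L-cong
      (≈L-trans (coeff-+ 0 (1L ∷ []) (T *ₚ X)) (≈L-trans (+L-cong (≈L-refl {1L})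
                (≈L-trans (coeff-single-* 0 tL1 X) (L.zeroʳ tL1))) (L.+-identityʳ 1L)))
      (coeff-≐ (X-*ₚ (Ψ a)) 0)) (L.+-identityʳ 1L))
    go (suc zero) _ = ≈L-trans (coeff-+ 1 c (X *ₚ Ψ a)) (≈L-trans (+L-cong
      (≈L-trans (coeff-+ 1 (1L ∷ []) (T *ₚ X)) (≈L-trans (L.+-identityˡ _)
                (≈L-trans (coeff-single-* 1 tL1 X) (L.*-identityʳ tL1))))
      (≈L-trans (coeff-≐ (X-*ₚ (Ψ a)) 1) Ψ-0)) (L.+-identityʳ tL1))
    go (suc (suc i)) (s≤s (s≤s ()))

  W-solution : IsSolution W
  W-solution = ≈-by-approximation (λ N → AtPrecision.P N (approx N)) (λ _ → []) (λ N → equation-≃ (W-≃ N))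
                 (λ N → series≃ λ i _ → ≈L-refl) approx-root

  W-unique : ∀ V → IsSolution V → V ≈ W
  W-unique V sol = ≈-by-approximation (λ N → truncate N V) approx (λ N → truncate-≃ N V) W-≃
    λ N → AtPrecision.root-unique N _ _ (solution⇒root sol (truncate-≃ N V)) (approx-root N)

  W-congruent : Congruent1+tx W
  W-congruent = coeff-≈ (Φ-mod-x² []) 0 (s≤s z≤n) , coeff-≈ (Φ-mod-x² (approx 1)) 1 (s≤s (s≤s z≤n))

  W-pde₁ : D-L W ≈ D-R W
  W-pde₁ = ≈-by-approximation (λ N → AtPrecision.DL N (approx N)) (λ N → AtPrecision.DR N (approx N))
    (λ N → DL-≃ (W-≃ N)) (λ N → DR-≃ (W-≃ N))
    λ N → AtPrecision.pde₁ N (approx N) (approx-root N)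

  W-pde₂ : D̃-L W ≈ D̃-R W
  W-pde₂ = ≈-by-approximation (λ N → AtPrecision.D̃L N (approx N)) (λ N → AtPrecision.D̃R N (approx N))
    (λ N → D̃L-≃ (W-≃ N)) (λ N → D̃R-≃ (W-≃ N))
    λ N → AtPrecision.pde₂ N (approx N) (approx-root N)

open import Defs
open import Data.Product using (Σ; _×_; _,_)
open PowerSeries using (W; W-solution; W-unique; W-congruent; W-pde₁; W-pde₂)

proposition5p5 : Σ R (λ W → IsSolution W
                         × (∀ (V : R) → IsSolution V → V ≈ W)
                         × Congruent1+tx W
                         × (D-L W ≈ D-R W)
                         × (D̃-L W ≈ D̃-R W))
proposition5p5 = W , W-solution , W-unique , W-congruent , W-pde₁ , W-pde₂
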